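{- Right reductions on boundary-connected diagrams are terminating: there is no infinite sequence of right exchanges starting from a valid boundary-connected diagram.
   Context: A diagram is a tuple $D=(S,N,H,I,O)$ with $S,N\in\mathbb N$ and $H,I,O:\{0,\dots,N-1\}\to\mathbb N$; $\Delta(n)=O(n)-I(n)$, $W(0)=S$, $W(n+1)=W(n)+\Delta(n)$; $D$ is valid if $W(n)\ge H(n)+I(n)$ for all $n<N$. Geometrically, the vertex at height $n$ (heights numbered top to bottom) has as inputs the wires $H(n),\dots,H(n)+I(n)-1$ among the $W(n)$ wires crossing level $n$ (numbered left to right) and as outputs the wires $H(n),\dots,H(n)+O(n)-1$ of level $n+1$; wire $k<H(n)$ of level $n$ continues as wire $k$ of level $n+1$ and wire $k\ge H(n)+I(n)$ continues as wire $k+\Delta(n)$. Edges are the resulting maximal wire chains; each joins two vertices, or a vertex and the top boundary (level $0$) or bottom boundary (level $N$), or the two boundaries. The underlying graph has the vertices of $D$ as vertices and the edges joining two vertices as edges. $D$ is boundary-connected if the underlying graph is connected, or every vertex is joined by a path in the underlying graph to a vertex incident to an edge reaching one of the two boundaries. For $0\le n\le N-2$, a right exchange at height $n$ is admissible when $H(n+1)\ge H(n)+O(n)$ and yields $D'$ identical to $D$ except $H'(n)=H(n+1)-\Delta(n)$, $I'(n)=I(n+1)$, $O'(n)=O(n+1)$, $H'(n+1)=H(n)$, $I'(n+1)=I(n)$, $O'(n+1)=O(n)$. -}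

module Defs where

import Data.Nat.Properties
open import Data.Nat using (ℕ; zero; suc; _+_; _∸_; _≤_; _<_; _≟_; _<?_)
open import Data.Fin using (Fin; toℕ; fromℕ<)
open import Data.Product using (Σ; _×_; _,_)
open import Data.Sum using (_⊎_)
open import Relation.Nullary using (yes; no)
open import Relation.Binary.PropositionalEquality using (_≡_)
open import Relation.Binary.Construct.Closure.ReflexiveTransitive using (Star)

record Diagram : Set where
  constructor diagram
  field
    S : ℕ
    N : ℕ
    H : Fin N → ℕ
    I : Fin N → ℕ
    O : Fin N → ℕ

open Diagram public

-- Value of a Fin N-indexed function at a natural-number height
-- (0 outside {0,…,N-1}; only ever used at heights < N).
at : {N : ℕ} → (Fin N → ℕ) → ℕ → ℕ
at {N} f n with n <? N
... | yes p = f (fromℕ< p)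
... | no _ = 0

-- Number of wires crossing level l (0 ≤ l ≤ N):
-- W(0) = S, W(n+1) = W(n) + O(n) - I(n).
-- (Truncated subtraction is exact whenever W(n) ≥ I(n), in particular
-- for every level of a valid diagram; validity is unaffected.)
W : Diagram → ℕ → ℕ
W D zero = S D
W D (suc n) = W D n + at (O D) n ∸ at (I D) n

Valid : Diagram → Set
Valid D = (n : Fin (N D)) → H D n + I D n ≤ W D (toℕ n)

-- Cont D n k k' : wire k of level n (not an input of vertex n)
-- continues as wire k' of level n+1.
Cont : Diagram → ℕ → ℕ → ℕ → Set
Cont D n k k' =
  n < N D × k < W D n ×
  ((k < at (H D) n × k' ≡ k)
   ⊎ (at (H D) n + at (I D) n ≤ k × k' ≡ k + at (O D) n ∸ at (I D) n))

-- Reach D l k m j : following the wire k of level l downwards (through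
-- no vertex) one arrives at wire j of level m.
data Reach (D : Diagram) : ℕ → ℕ → ℕ → ℕ → Set where
  here : ∀ {l k} → Reach D l k l k
  step : ∀ {l k m j j'} → Reach D l k m j → Cont D m j j' → Reach D l k (suc m) j'

-- Output wire k of vertex a (at level a+1).
IsOutput : (D : Diagram) → Fin (N D) → ℕ → Set
IsOutput D a k = H D a ≤ k × k < H D a + O D a

-- Input wire k of vertex a (at level a).
IsInput : (D : Diagram) → Fin (N D) → ℕ → Set
IsInput D a k = H D a ≤ k × k < H D a + I D a

EdgeDown : (D : Diagram) → Fin (N D) → Fin (N D) → Set
EdgeDown D a b = Σ ℕ λ k → Σ ℕ λ k' →
  IsOutput D a k × Reach D (suc (toℕ a)) k (toℕ b) k' × IsInput D b k'

Adj : (D : Diagram) → Fin (N D) → Fin (N D) → Set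
Adj D a b = EdgeDown D a b ⊎ EdgeDown D b a

Path : (D : Diagram) → Fin (N D) → Fin (N D) → Set
Path D = Star (Adj D)

TouchesBoundary : (D : Diagram) → Fin (N D) → Set
TouchesBoundary D a =
  (Σ ℕ λ k → Σ ℕ λ k' → k < S D × Reach D 0 k (toℕ a) k' × IsInput D a k')
  ⊎ (Σ ℕ λ k → Σ ℕ λ k' → IsOutput D a k × Reach D (suc (toℕ a)) k (N D) k')

BoundaryConnected : Diagram → Set
BoundaryConnected D =
  ((a b : Fin (N D)) → Path D a b)
  ⊎ ((a : Fin (N D)) → Σ (Fin (N D)) λ b → Path D a b × TouchesBoundary D b)

module _ (D : Diagram) (n : ℕ) (p : suc n < N D) where
  private
    i : Fin (N D)
    i = fromℕ< (Data.Nat.Properties.<-trans (Data.Nat.Properties.n<1+n n) p)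
    j : Fin (N D)
    j = fromℕ< p

  RightAdmissible : Set
  RightAdmissible = H D i + O D i ≤ H D j

  -- H'(n) = H(n+1) - Δ(n) = H(n+1) + I(n) - O(n)  (exact under admissibility)
  rightExchange : Diagram
  rightExchange = diagram (S D) (N D) H' I' O'
    where
    upd : ℕ → ℕ → (Fin (N D) → ℕ) → Fin (N D) → ℕ
    upd x y f m with toℕ m ≟ n | toℕ m ≟ suc n
    ... | yes _ | _ = x
    ... | no _ | yes _ = y
    ... | no _ | no _ = f m
    H' = upd (H D j + I D i ∸ O D i) (H D i) (H D)
    I' = upd (I D j) (I D i) (I D)
    O' = upd (O D j) (O D i) (O D)

RightStep : Diagram → Diagram → Set
RightStep D D' = Σ ℕ λ n → Σ (suc n < N D) λ p →
  RightAdmissible D n p × D' ≡ rightExchange D n p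

InfiniteRightSequence : Diagram → Set
InfiniteRightSequence D = Σ (ℕ → Diagram) λ seq →
  seq 0 ≡ D × ((k : ℕ) → RightStep (seq k) (seq (suc k)))

module Submission where

-- The proof exhibits a nonnegative integer potential that every right
-- exchange lowers by at least one.  A diagram is first read as an
-- integer "layout" (offsets, input and output arities per level), where
-- wires are followed level by level with exact integer arithmetic.  A wire
-- running past vertex c on its left contributes +1 at c, on its right -1.
-- For each ordered pair of vertices (a, b) we choose a witness: a walk in
-- the underlying graph ending at a and starting either at b or at a vertex
-- touching the boundary (through a boundary edge).  Its weight is the sum,
-- over the edges of the walk and the boundary edge, of their signed sides
-- at b; the slack 1 + length - weight is nonnegative.
--
-- A right exchange at n swaps vertices n and n+1 (transposition τ).  Every
-- witness for (τ a, τ b) transports to a witness for (a, b) of the same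
-- length whose weight grows by exactly [{a,b} = {n,n+1}]: edges joining the
-- two swapped vertices now pass each other.  Hence the sum Ψ of the slacks
-- over all pairs drops by at least one, and an infinite sequence of right
-- exchanges would make Ψ negative.

open import Defs
open import Data.Nat as ℕ using (ℕ; zero; suc; _≟_)
import Data.Nat.Properties as ℕP
open import Data.Fin using (Fin; toℕ; fromℕ<)
import Data.Fin.Properties as FinP
open import Data.Integer as ℤ using (ℤ; +_; 0ℤ; 1ℤ; -1ℤ; _+_; _-_; -_; _≤_; _<_; _<?_)
import Data.Integer.Properties as ℤP
open import Data.Integer.Tactic.RingSolver using (solve-∀)
open import Data.Product using (Σ; _×_; _,_; proj₁; proj₂)
open import Data.Sum using (_⊎_; inj₁; inj₂) renaming (swap to ⊎-swap)
open import Data.Unit using (⊤; tt)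
open import Data.Empty using (⊥; ⊥-elim)
open import Relation.Nullary using (¬_; yes; no)
open import Relation.Binary.PropositionalEquality
open import Function using (_∘_)
open import Relation.Binary.Definitions using (tri<; tri≈; tri>)
open import Relation.Binary.Construct.Closure.ReflexiveTransitive
  using (Star; ε; _◅_; gmap; reverse)

NonNeg : ℤ → Set
NonNeg x = 0ℤ ≤ x

≤⇒nonneg : ∀ {a b} → a ≤ b → NonNeg (b - a)
≤⇒nonneg = ℤP.i≤j⇒0≤j-i

nonneg⇒≤ : ∀ {a b} → NonNeg (b - a) → a ≤ b
nonneg⇒≤ {a} {b} h = subst₂ _≤_ (ℤP.+-identityʳ a) (a+[b-a]≡b a b) (ℤP.+-monoʳ-≤ a h)
  where
  a+[b-a]≡b : ∀ a b → a + (b - a) ≡ b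
  a+[b-a]≡b = solve-∀

<⇒nonneg : ∀ {a b} → a < b → NonNeg (b - a - 1ℤ)
<⇒nonneg {a} {b} h = subst NonNeg (reorder a b) (≤⇒nonneg (ℤP.i<j⇒suc[i]≤j h))
  where
  reorder : ∀ a b → b - (1ℤ + a) ≡ b - a - 1ℤ
  reorder = solve-∀

nonneg⇒< : ∀ {a b} → NonNeg (b - a - 1ℤ) → a < b
nonneg⇒< {a} {b} h = ℤP.suc[i]≤j⇒i<j (nonneg⇒≤ (subst NonNeg (reorder a b) h))
  where
  reorder : ∀ a b → b - a - 1ℤ ≡ b - (1ℤ + a)
  reorder = solve-∀

nonneg-sum : ∀ {x y z} → NonNeg x → NonNeg y → x + y ≡ z → NonNeg z
nonneg-sum hx hy e = subst NonNeg e (ℤP.+-mono-≤ hx hy)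

nonneg-ℕ : ∀ m → NonNeg (+ m)
nonneg-ℕ m = ℤ.+≤+ ℕ.z≤n

≤-minus-nonneg : ∀ {h i p} → NonNeg i → h + i ≤ p → h ≤ p
≤-minus-nonneg {h} {i} {p} i≥0 h+i≤p = nonneg⇒≤ (nonneg-sum (≤⇒nonneg h+i≤p) i≥0 (drop p h i))
  where
  drop : ∀ p h i → (p - (h + i)) + i ≡ p - h
  drop = solve-∀

+-∸ : ∀ m k → k ℕ.≤ m → + (m ℕ.∸ k) ≡ + m - + k
+-∸ m k k≤m = sym (trans (ℤP.m-n≡m⊖n m k) (ℤP.≤-⊖ k≤m))

-- An integer layout records, for every level t, the offset pos t of the
-- vertex at height t and its numbers of inputs and outputs.  A diagram is
-- read as a layout in the bridge section below.

record Layout : Set where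
  constructor layout
  field
    pos ins outs : ℕ → ℤ

open Layout

-- The position of wire p after crossing, without meeting it, a vertex with
-- offset h, i inputs and o outputs.
across : ℤ → ℤ → ℤ → ℤ → ℤ
across h i o p with p <? h
... | yes _ = p
... | no _ = p + o - i

across-left : ∀ {h i o p} → p < h → across h i o p ≡ p
across-left {h} {i} {o} {p} p<h with p <? h
... | yes _ = refl
... | no p≮h = ⊥-elim (p≮h p<h)

across-right : ∀ {h i o p} → h ≤ p → across h i o p ≡ p + o - i
across-right {h} {i} {o} {p} h≤p with p <? h
... | yes p<h = ⊥-elim (ℤP.<-irrefl refl (ℤP.<-≤-trans p<h h≤p))
... | no _ = refl

pass : Layout → ℕ → ℤ → ℤ
pass L t = across (pos L t) (ins L t) (outs L t)

follow : Layout → ℕ → ℤ → ℕ → ℤ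
follow L l k zero = k
follow L l k (suc d) = follow L (suc l) (pass L l k) d

Clear : Layout → ℕ → ℤ → Set
Clear L t p = p < pos L t ⊎ pos L t + ins L t ≤ p

Run : Layout → ℕ → ℤ → ℕ → Set
Run L l k zero = ⊤
Run L l k (suc d) = Clear L l k × Run L (suc l) (pass L l k) d

side : ℤ → ℤ → ℤ
side p h with p <? h
... | yes _ = 1ℤ
... | no _ = -1ℤ

side-left : ∀ {p h} → p < h → side p h ≡ 1ℤ
side-left {p} {h} p<h with p <? h
... | yes _ = refl
... | no p≮h = ⊥-elim (p≮h p<h)

side-right : ∀ {p h} → h ≤ p → side p h ≡ -1ℤ
side-right {p} {h} h≤p with p <? h
... | yes p<h = ⊥-elim (ℤP.<-irrefl refl (ℤP.<-≤-trans p<h h≤p))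
... | no _ = refl

side-unit : ∀ p h → side p h ≡ 1ℤ ⊎ side p h ≡ -1ℤ
side-unit p h with p <? h
... | yes _ = inj₁ refl
... | no _ = inj₂ refl

onLevel : ℕ → ℕ → ℤ → ℤ
onLevel l c s with l ≟ c
... | yes _ = s
... | no _ = 0ℤ

onLevel-same : ∀ l s → onLevel l l s ≡ s
onLevel-same l s with l ≟ l
... | yes _ = refl
... | no l≢l = ⊥-elim (l≢l refl)

onLevel-other : ∀ {l c} s → l ≢ c → onLevel l c s ≡ 0ℤ
onLevel-other {l} {c} s l≢c with l ≟ c
... | yes l≡c = ⊥-elim (l≢c l≡c)
... | no _ = refl

onLevel-neg : ∀ l c s → onLevel l c (- s) ≡ - onLevel l c s
onLevel-neg l c s with l ≟ c
... | yes _ = refl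
... | no _ = refl

onLevel-nonneg : ∀ l c → NonNeg (onLevel l c 1ℤ)
onLevel-nonneg l c with l ≟ c
... | yes _ = nonneg-ℕ 1
... | no _ = nonneg-ℕ 0

sides : Layout → ℕ → ℤ → ℕ → ℕ → ℤ
sides L l k zero c = 0ℤ
sides L l k (suc d) c = onLevel l c (side k (pos L l)) + sides L (suc l) (pass L l k) d c

-- Output wire k of the vertex at level x (a wire of level x+1) and input
-- wire q of the vertex at level z (a wire of level z).
IsOut : Layout → ℕ → ℤ → Set
IsOut L x k = pos L x ≤ k × k < pos L x + outs L x

IsIn : Layout → ℕ → ℤ → Set
IsIn L z q = pos L z ≤ q × q < pos L z + ins L z

follow-last : ∀ L l k d → follow L l k (suc d) ≡ pass L (l ℕ.+ d) (follow L l k d)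
follow-last L l k zero = cong (λ t → pass L t k) (sym (ℕP.+-identityʳ l))
follow-last L l k (suc d) =
  trans (follow-last L (suc l) (pass L l k) d)
        (cong (λ t → pass L t (follow L (suc l) (pass L l k) d)) (sym (ℕP.+-suc l d)))

run-init : ∀ L l k d → Run L l k (suc d) → Run L l k d × Clear L (l ℕ.+ d) (follow L l k d)
run-init L l k zero (clear , _) = tt , subst (λ t → Clear L t k) (sym (ℕP.+-identityʳ l)) clear
run-init L l k (suc d) (clear , run) with run-init L (suc l) (pass L l k) d run
... | run′ , last =
  (clear , run′) , subst (λ t → Clear L t (follow L (suc l) (pass L l k) d)) (sym (ℕP.+-suc l d)) last

run-snoc : ∀ L l k d → Run L l k d → Clear L (l ℕ.+ d) (follow L l k d) → Run L l k (suc d)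
run-snoc L l k zero _ last = subst (λ t → Clear L t k) (ℕP.+-identityʳ l) last , tt
run-snoc L l k (suc d) (clear , run) last =
  clear , run-snoc L (suc l) (pass L l k) d run
            (subst (λ t → Clear L t (follow L (suc l) (pass L l k) d)) (ℕP.+-suc l d) last)

sides-last : ∀ L l k d c →
  sides L l k (suc d) c ≡ sides L l k d c + onLevel (l ℕ.+ d) c (side (follow L l k d) (pos L (l ℕ.+ d)))
sides-last L l k zero c =
  trans (ℤP.+-identityʳ _)
        (trans (cong (λ t → onLevel t c (side k (pos L t))) (sym (ℕP.+-identityʳ l)))
               (sym (ℤP.+-identityˡ _)))
sides-last L l k (suc d) c =
  trans (cong (λ z → first + z) (sides-last L (suc l) (pass L l k) d c))
        (trans (sym (ℤP.+-assoc first _ _))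
               (cong (λ t → first + sides L (suc l) (pass L l k) d c
                              + onLevel t c (side (follow L (suc l) (pass L l k) d) (pos L t)))
                     (sym (ℕP.+-suc l d))))
  where
  first = onLevel l c (side k (pos L l))

-- A run crosses each level at most once, so its side at any level is
-- -1, 0 or 1.
sides-below : ∀ L l k d c → c ℕ.< l → sides L l k d c ≡ 0ℤ
sides-below L l k zero c c<l = refl
sides-below L l k (suc d) c c<l =
  trans (cong₂ _+_ (onLevel-other _ (λ l≡c → ℕP.<-irrefl (sym l≡c) c<l))
                   (sides-below L (suc l) (pass L l k) d c (ℕP.m≤n⇒m≤1+n c<l)))
        (ℤP.+-identityˡ _)

sides-bounded : ∀ L l k d c → NonNeg (1ℤ - sides L l k d c) × NonNeg (1ℤ + sides L l k d c)
sides-bounded L l k zero c = nonneg-ℕ 1 , nonneg-ℕ 1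
sides-bounded L l k (suc d) c with l ≟ c
... | yes refl rewrite sides-below L (suc l) (pass L l k) d l (ℕP.n<1+n l) with side-unit k (pos L l)
...   | inj₁ e rewrite e = nonneg-ℕ 0 , nonneg-ℕ 2
...   | inj₂ e rewrite e = nonneg-ℕ 2 , nonneg-ℕ 0
sides-bounded L l k (suc d) c | no _ with sides-bounded L (suc l) (pass L l k) d c
... | upper , lower = subst NonNeg (sub0 (sides L (suc l) (pass L l k) d c)) upper ,
                     subst NonNeg (add0 (sides L (suc l) (pass L l k) d c)) lower
  where
  sub0 : ∀ x → 1ℤ - x ≡ 1ℤ - (0ℤ + x)
  sub0 = solve-∀
  add0 : ∀ x → 1ℤ + x ≡ 1ℤ + (0ℤ + x)
  add0 = solve-∀

module Transposition (n : ℕ) where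

  n≢1+n : n ≢ suc n
  n≢1+n = ℕP.1+n≢n ∘ sym

  data Level (c : ℕ) : Set where
    is-n   : c ≡ n → Level c
    is-1+n : c ≡ suc n → Level c
    other  : c ≢ n → c ≢ suc n → Level c

  level : ∀ c → Level c
  level c with c ≟ n
  ... | yes c≡n = is-n c≡n
  ... | no c≢n with c ≟ suc n
  ...   | yes c≡1+n = is-1+n c≡1+n
  ...   | no c≢1+n = other c≢n c≢1+n

  τ : ℕ → ℕ
  τ t with t ≟ n
  ... | yes _ = suc n
  ... | no _ with t ≟ suc n
  ...   | yes _ = n
  ...   | no _ = t

  τ-n : τ n ≡ suc n
  τ-n with n ≟ n
  ... | yes _ = refl
  ... | no n≢n = ⊥-elim (n≢n refl)

  τ-1+n : τ (suc n) ≡ n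
  τ-1+n with suc n ≟ n
  ... | yes 1+n≡n = ⊥-elim (ℕP.1+n≢n 1+n≡n)
  ... | no _ with suc n ≟ suc n
  ...   | yes _ = refl
  ...   | no 1+n≢1+n = ⊥-elim (1+n≢1+n refl)

  τ-other : ∀ {t} → t ≢ n → t ≢ suc n → τ t ≡ t
  τ-other {t} t≢n t≢1+n with t ≟ n
  ... | yes t≡n = ⊥-elim (t≢n t≡n)
  ... | no _ with t ≟ suc n
  ...   | yes t≡1+n = ⊥-elim (t≢1+n t≡1+n)
  ...   | no _ = refl

  τ-involutive : ∀ t → τ (τ t) ≡ t
  τ-involutive t with level t
  ... | is-n refl = trans (cong τ τ-n) τ-1+n
  ... | is-1+n refl = trans (cong τ τ-1+n) τ-n
  ... | other t≢n t≢1+n = trans (cong τ (τ-other t≢n t≢1+n)) (τ-other t≢n t≢1+n)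

  onLevel-τ-other : ∀ l c s → l ≢ n → l ≢ suc n → onLevel l (τ c) s ≡ onLevel l c s
  onLevel-τ-other l c s l≢n l≢1+n with level c
  ... | is-n refl = trans (cong (λ t → onLevel l t s) τ-n)
                          (trans (onLevel-other s l≢1+n) (sym (onLevel-other s l≢n)))
  ... | is-1+n refl = trans (cong (λ t → onLevel l t s) τ-1+n)
                            (trans (onLevel-other s l≢n) (sym (onLevel-other s l≢1+n)))
  ... | other c≢n c≢1+n = cong (λ t → onLevel l t s) (τ-other c≢n c≢1+n)

  onLevel-τ-n : ∀ c s → onLevel n (τ c) s ≡ onLevel (suc n) c s
  onLevel-τ-n c s with level c
  ... | is-n refl = trans (cong (λ t → onLevel n t s) τ-n)
                          (trans (onLevel-other s n≢1+n) (sym (onLevel-other s ℕP.1+n≢n)))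
  ... | is-1+n refl = trans (cong (λ t → onLevel n t s) τ-1+n)
                            (trans (onLevel-same n s) (sym (onLevel-same (suc n) s)))
  ... | other c≢n c≢1+n = trans (cong (λ t → onLevel n t s) (τ-other c≢n c≢1+n))
                                (trans (onLevel-other {n} {c} s (c≢n ∘ sym))
                                       (sym (onLevel-other {suc n} {c} s (c≢1+n ∘ sym))))

  onLevel-τ-1+n : ∀ c s → onLevel (suc n) (τ c) s ≡ onLevel n c s
  onLevel-τ-1+n c s with level c
  ... | is-n refl = trans (cong (λ t → onLevel (suc n) t s) τ-n)
                          (trans (onLevel-same (suc n) s) (sym (onLevel-same n s)))
  ... | is-1+n refl = trans (cong (λ t → onLevel (suc n) t s) τ-1+n)
                            (trans (onLevel-other s ℕP.1+n≢n) (sym (onLevel-other s n≢1+n)))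
  ... | other c≢n c≢1+n = trans (cong (λ t → onLevel (suc n) t s) (τ-other c≢n c≢1+n))
                                (trans (onLevel-other {suc n} {c} s (c≢1+n ∘ sym))
                                       (sym (onLevel-other {n} {c} s (c≢n ∘ sym))))

  -- δ c y = 1 exactly when {c, y} = {n, n+1}: the crossing gained at level c
  -- by an edge end at the vertex of level y.
  δ : ℕ → ℕ → ℤ
  δ c y with y ≟ n
  ... | yes _ = onLevel (suc n) c 1ℤ
  ... | no _ with y ≟ suc n
  ...   | yes _ = onLevel n c 1ℤ
  ...   | no _ = 0ℤ

  δ-n : ∀ c → δ c n ≡ onLevel (suc n) c 1ℤ
  δ-n c with n ≟ n
  ... | yes _ = refl
  ... | no n≢n = ⊥-elim (n≢n refl)

  δ-1+n : ∀ c → δ c (suc n) ≡ onLevel n c 1ℤ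
  δ-1+n c with suc n ≟ n
  ... | yes 1+n≡n = ⊥-elim (ℕP.1+n≢n 1+n≡n)
  ... | no _ with suc n ≟ suc n
  ...   | yes _ = refl
  ...   | no 1+n≢1+n = ⊥-elim (1+n≢1+n refl)

  δ-other : ∀ c {y} → y ≢ n → y ≢ suc n → δ c y ≡ 0ℤ
  δ-other c {y} y≢n y≢1+n with y ≟ n
  ... | yes y≡n = ⊥-elim (y≢n y≡n)
  ... | no _ with y ≟ suc n
  ...   | yes y≡1+n = ⊥-elim (y≢1+n y≡1+n)
  ...   | no _ = refl

  δ-diagonal : ∀ c → δ c c ≡ 0ℤ
  δ-diagonal c with level c
  ... | is-n refl = trans (δ-n n) (onLevel-other 1ℤ ℕP.1+n≢n)
  ... | is-1+n refl = trans (δ-1+n (suc n)) (onLevel-other 1ℤ n≢1+n)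
  ... | other c≢n c≢1+n = δ-other c c≢n c≢1+n

  δ-nonneg : ∀ c y → NonNeg (δ c y)
  δ-nonneg c y with level y
  ... | is-n refl = subst NonNeg (sym (δ-n c)) (onLevel-nonneg (suc n) c)
  ... | is-1+n refl = subst NonNeg (sym (δ-1+n c)) (onLevel-nonneg n c)
  ... | other y≢n y≢1+n = subst NonNeg (sym (δ-other c y≢n y≢1+n)) (nonneg-ℕ 0)

record RightExchange (L L' : Layout) (n : ℕ) : Set where
  field
    admissible : pos L n + outs L n ≤ pos L (suc n)
    ins₀≥0     : NonNeg (ins L n)
    outs₀≥0    : NonNeg (outs L n)
    ins₁≥0     : NonNeg (ins L (suc n))
    outs₁≥0    : NonNeg (outs L (suc n))
    pos-n      : pos L' n ≡ pos L (suc n) + ins L n - outs L n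
    ins-n      : ins L' n ≡ ins L (suc n)
    outs-n     : outs L' n ≡ outs L (suc n)
    pos-1+n    : pos L' (suc n) ≡ pos L n
    ins-1+n    : ins L' (suc n) ≡ ins L n
    outs-1+n   : outs L' (suc n) ≡ outs L n
    pos-other  : ∀ t → t ≢ n → t ≢ suc n → pos L' t ≡ pos L t
    ins-other  : ∀ t → t ≢ n → t ≢ suc n → ins L' t ≡ ins L t
    outs-other : ∀ t → t ≢ n → t ≢ suc n → outs L' t ≡ outs L t

module Unaffected {L L' : Layout} {n : ℕ} (X : RightExchange L L' n) where
  open RightExchange X
  open Transposition n

  pass-other : ∀ {l} p → l ≢ n → l ≢ suc n → pass L' l p ≡ pass L l p
  pass-other {l} p l≢n l≢1+n rewrite pos-other l l≢n l≢1+n | ins-other l l≢n l≢1+n | outs-other l l≢n l≢1+n = refl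

  clear-other : ∀ {l} p → l ≢ n → l ≢ suc n → Clear L l p → Clear L' l p
  clear-other {l} p l≢n l≢1+n clear rewrite pos-other l l≢n l≢1+n | ins-other l l≢n l≢1+n = clear

  side-other : ∀ {l} p → l ≢ n → l ≢ suc n → side p (pos L' l) ≡ side p (pos L l)
  side-other {l} p l≢n l≢1+n rewrite pos-other l l≢n l≢1+n = refl

  out-other : ∀ {x k} → x ≢ n → x ≢ suc n → IsOut L x k → IsOut L' x k
  out-other {x} x≢n x≢1+n out rewrite pos-other x x≢n x≢1+n | outs-other x x≢n x≢1+n = out

  in-other : ∀ {x k} → x ≢ n → x ≢ suc n → IsIn L x k → IsIn L' x k
  in-other {x} x≢n x≢1+n inp rewrite pos-other x x≢n x≢1+n | ins-other x x≢n x≢1+n = inp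

  Transported : ℕ → ℤ → ℕ → Set
  Transported l k d =
    Run L' l k d × follow L' l k d ≡ follow L l k d × (∀ c → sides L' l k d (τ c) ≡ sides L l k d c)

  Avoids : ℕ → ℕ → Set
  Avoids l d = (l ℕ.+ d ℕ.≤ n) ⊎ (suc (suc n) ℕ.≤ l)

  avoids-head : ∀ {l d} → Avoids l (suc d) → (l ≢ n) × (l ≢ suc n)
  avoids-head {l} {d} (inj₁ end≤n) = (λ l≡n → ℕP.<-irrefl l≡n l<n) ,
                                     (λ l≡1+n → ℕP.<-irrefl l≡1+n (ℕP.<-trans l<n (ℕP.n<1+n n)))
    where
    l<n : l ℕ.< n
    l<n = ℕP.<-≤-trans (subst (l ℕ.<_) (sym (ℕP.+-suc l d)) (ℕ.s≤s (ℕP.m≤m+n l d))) end≤n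
  avoids-head (inj₂ 2+n≤l) = (λ l≡n → ℕP.<-irrefl (sym l≡n) (ℕP.<-trans (ℕP.n<1+n n) 2+n≤l)) ,
                             (λ l≡1+n → ℕP.<-irrefl (sym l≡1+n) 2+n≤l)

  avoids-tail : ∀ {l d} → Avoids l (suc d) → Avoids (suc l) d
  avoids-tail {l} {d} (inj₁ end≤n) = inj₁ (subst (ℕ._≤ n) (ℕP.+-suc l d) end≤n)
  avoids-tail (inj₂ 2+n≤l) = inj₂ (ℕP.m≤n⇒m≤1+n 2+n≤l)

  run-avoiding : ∀ l k d → Avoids l d → Run L l k d → Transported l k d
  run-avoiding l k zero _ _ = tt , refl , (λ c → refl)
  run-avoiding l k (suc d) avoid (clear , run) with avoids-head avoid
  ... | l≢n , l≢1+n with run-avoiding (suc l) (pass L l k) d (avoids-tail avoid) run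
  ... | run′ , end , sides′ rewrite pass-other k l≢n l≢1+n =
    (clear-other k l≢n l≢1+n clear , run′) , end ,
    (λ c → cong₂ _+_ (trans (onLevel-τ-other l c _ l≢n l≢1+n) (cong (onLevel l c) (side-other k l≢n l≢1+n)))
                     (sides′ c))

module Crossing {L L' : Layout} {n : ℕ} (X : RightExchange L L' n) where
  open RightExchange X
  open Transposition n
  open Unaffected X

  private
    h₀ = pos L n
    i₀ = ins L n
    o₀ = outs L n
    h₁ = pos L (suc n)
    i₁ = ins L (suc n)
    o₁ = outs L (suc n)

  -- Left of vertex n means left of vertex n+1, by admissibility.
  left-n⇒left-1+n : ∀ {p} → p < h₀ → p < h₁
  left-n⇒left-1+n {p} p<h₀ =
    nonneg⇒< (nonneg-sum (<⇒nonneg p<h₀) (nonneg-sum (≤⇒nonneg admissible) outs₀≥0 refl) (via-outputs h₀ p h₁ o₀))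
    where
    via-outputs : ∀ h p h₁ o → (h - p - 1ℤ) + ((h₁ - (h + o)) + o) ≡ h₁ - p - 1ℤ
    via-outputs = solve-∀

  PairCrossed : ℤ → Set
  PairCrossed p =
    Clear L' n p × Clear L' (suc n) (pass L' n p) ×
    pass L' (suc n) (pass L' n p) ≡ pass L (suc n) (pass L n p) ×
    side p (pos L' n) ≡ side (pass L n p) h₁ ×
    side (pass L' n p) (pos L' (suc n)) ≡ side p h₀

  cross-left : ∀ p → p < h₀ → PairCrossed p
  cross-left p p<h₀ =
    inj₁ p<pos′ , subst (Clear L' (suc n)) (sym stays′) (inj₁ p<pos′₁) ,
    trans (cong (pass L' (suc n)) stays′)
          (trans (across-left p<pos′₁) (sym (trans (cong (pass L (suc n)) stays) (across-left (left-n⇒left-1+n p<h₀))))) ,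
    trans (side-left p<pos′) (sym (trans (cong (λ x → side x h₁) stays) (side-left (left-n⇒left-1+n p<h₀)))) ,
    trans (cong (λ x → side x (pos L' (suc n))) stays′) (trans (side-left p<pos′₁) (sym (side-left p<h₀)))
    where
    gap = ≤⇒nonneg admissible
    via-inputs : ∀ h p h₁ o i → (h - p - 1ℤ) + ((h₁ - (h + o)) + i) ≡ h₁ + i - o - p - 1ℤ
    via-inputs = solve-∀
    stays : pass L n p ≡ p
    stays = across-left p<h₀
    p<pos′ : p < pos L' n
    p<pos′ = subst (p <_) (sym pos-n)
               (nonneg⇒< (nonneg-sum (<⇒nonneg p<h₀) (nonneg-sum gap ins₀≥0 refl) (via-inputs h₀ p h₁ o₀ i₀)))
    stays′ : pass L' n p ≡ p
    stays′ = across-left p<pos′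
    p<pos′₁ : p < pos L' (suc n)
    p<pos′₁ = subst (p <_) (sym pos-1+n) p<h₀

  cross-between : ∀ p → h₀ ≤ p → h₀ + i₀ ≤ p → p + o₀ - i₀ < h₁ → PairCrossed p
  cross-between p h₀≤p clear₀ q<h₁ =
    inj₁ p<pos′ , subst (Clear L' (suc n)) (sym stays′) (inj₂ clear′₁) ,
    trans (cong (pass L' (suc n)) stays′)
          (trans moves′ (sym (trans (cong (pass L (suc n)) moves) (across-left q<h₁)))) ,
    trans (side-left p<pos′) (sym (trans (cong (λ x → side x h₁) moves) (side-left q<h₁))) ,
    trans (cong (λ x → side x (pos L' (suc n))) stays′)
          (trans (side-right pos′₁≤p) (sym (side-right h₀≤p)))
    where
    shifted : ∀ h₁ p o i → h₁ - (p + o - i) - 1ℤ ≡ h₁ + i - o - p - 1ℤ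
    shifted = solve-∀
    moves : pass L n p ≡ p + o₀ - i₀
    moves = across-right h₀≤p
    p<pos′ : p < pos L' n
    p<pos′ = subst (p <_) (sym pos-n) (nonneg⇒< (subst NonNeg (shifted h₁ p o₀ i₀) (<⇒nonneg q<h₁)))
    stays′ : pass L' n p ≡ p
    stays′ = across-left p<pos′
    pos′₁≤p : pos L' (suc n) ≤ p
    pos′₁≤p = subst (_≤ p) (sym pos-1+n) h₀≤p
    clear′₁ : pos L' (suc n) + ins L' (suc n) ≤ p
    clear′₁ = subst (_≤ p) (sym (cong₂ _+_ pos-1+n ins-1+n)) clear₀
    moves′ : pass L' (suc n) p ≡ p + o₀ - i₀
    moves′ = trans (across-right pos′₁≤p) (cong₂ (λ o i → p + o - i) outs-1+n ins-1+n)

  cross-right : ∀ p → h₀ ≤ p → h₀ + i₀ ≤ p → h₁ + i₁ ≤ p + o₀ - i₀ → PairCrossed p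
  cross-right p h₀≤p clear₀ clear₁ =
    inj₂ clear′₀ , subst (Clear L' (suc n)) (sym moves′) (inj₂ clear′₁) ,
    trans (cong (pass L' (suc n)) moves′)
          (trans moves′₁ (trans (commute p o₀ i₀ o₁ i₁)
                                (sym (trans (cong (pass L (suc n)) moves) (across-right h₁≤q))))) ,
    trans (side-right pos′≤p) (sym (trans (cong (λ x → side x h₁) moves) (side-right h₁≤q))) ,
    trans (cong (λ x → side x (pos L' (suc n))) moves′)
          (trans (side-right (subst (_≤ p + o₁ - i₁) (sym pos-1+n) h₀≤r)) (sym (side-right h₀≤p)))
    where
    regroup : ∀ p o i h₁ i₁ → p + o - i - (h₁ + i₁) ≡ p - (h₁ + i - o + i₁)
    regroup = solve-∀
    climb : ∀ p o i h₁ i₁ h o₁ → (p + o - i - (h₁ + i₁)) + ((h₁ - (h + o)) + o₁) ≡ p + o₁ - i₁ - (h + i)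
    climb = solve-∀
    commute : ∀ p o i o₁ i₁ → p + o₁ - i₁ + o - i ≡ p + o - i + o₁ - i₁
    commute = solve-∀
    moves : pass L n p ≡ p + o₀ - i₀
    moves = across-right h₀≤p
    h₁≤q : h₁ ≤ p + o₀ - i₀
    h₁≤q = ≤-minus-nonneg ins₁≥0 clear₁
    clear′₀ : pos L' n + ins L' n ≤ p
    clear′₀ = subst (_≤ p) (sym (cong₂ _+_ pos-n ins-n))
                (nonneg⇒≤ (subst NonNeg (regroup p o₀ i₀ h₁ i₁) (≤⇒nonneg clear₁)))
    pos′≤p : pos L' n ≤ p
    pos′≤p = ≤-minus-nonneg (subst NonNeg (sym ins-n) ins₁≥0) clear′₀
    moves′ : pass L' n p ≡ p + o₁ - i₁
    moves′ = trans (across-right pos′≤p) (cong₂ (λ o i → p + o - i) outs-n ins-n)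
    clear₀′ : h₀ + i₀ ≤ p + o₁ - i₁
    clear₀′ = nonneg⇒≤ (nonneg-sum (≤⇒nonneg clear₁) (nonneg-sum (≤⇒nonneg admissible) outs₁≥0 refl)
                                   (climb p o₀ i₀ h₁ i₁ h₀ o₁))
    clear′₁ : pos L' (suc n) + ins L' (suc n) ≤ p + o₁ - i₁
    clear′₁ = subst (_≤ p + o₁ - i₁) (sym (cong₂ _+_ pos-1+n ins-1+n)) clear₀′
    h₀≤r : h₀ ≤ p + o₁ - i₁
    h₀≤r = ≤-minus-nonneg ins₀≥0 clear₀′
    moves′₁ : pass L' (suc n) (p + o₁ - i₁) ≡ p + o₁ - i₁ + o₀ - i₀
    moves′₁ = trans (across-right (subst (_≤ p + o₁ - i₁) (sym pos-1+n) h₀≤r))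
                    (cong₂ (λ o i → p + o₁ - i₁ + o - i) outs-1+n ins-1+n)

  cross-pair : ∀ p → Clear L n p → Clear L (suc n) (pass L n p) → PairCrossed p
  cross-pair p (inj₁ p<h₀) _ = cross-left p p<h₀
  cross-pair p (inj₂ clear₀) clear₁
    with subst (Clear L (suc n)) (across-right (≤-minus-nonneg ins₀≥0 clear₀)) clear₁
  ... | inj₁ q<h₁ = cross-between p (≤-minus-nonneg ins₀≥0 clear₀) clear₀ q<h₁
  ... | inj₂ clear₁′ = cross-right p (≤-minus-nonneg ins₀≥0 clear₀) clear₀ clear₁′

  private
    swap-heads : ∀ a b r → b + (a + r) ≡ a + (b + r)
    swap-heads = solve-∀
    ≤n⇒≢1+n : ∀ {l} → l ℕ.≤ n → l ≢ suc n
    ≤n⇒≢1+n l≤n = ℕP.<⇒≢ (ℕ.s≤s l≤n)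

  run-across : ∀ l k d → l ℕ.≤ n → suc (suc n) ℕ.≤ l ℕ.+ d → Run L l k d → Transported l k d
  run-across l k zero l≤n 2+n≤l _ =
    ⊥-elim (ℕP.<-irrefl refl (ℕP.≤-trans (ℕ.s≤s l≤n)
             (ℕP.≤-trans (ℕP.n≤1+n (suc n)) (subst (suc (suc n) ℕ.≤_) (ℕP.+-identityʳ l) 2+n≤l))))
  run-across l k (suc d) l≤n 2+n≤end run with l ≟ n
  run-across l k (suc zero) l≤n 2+n≤end run | yes refl =
    ⊥-elim (ℕP.<-irrefl refl (subst (suc (suc l) ℕ.≤_) (ℕP.+-comm l 1) 2+n≤end))
  run-across l k (suc (suc d)) l≤n 2+n≤end (clear₀ , clear₁ , rest) | yes refl
    with cross-pair k clear₀ clear₁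
       | run-avoiding (suc (suc l)) (pass L (suc l) (pass L l k)) d (inj₂ ℕP.≤-refl) rest
  ... | clear′₀ , clear′₁ , same-end , side₀ , side₁ | rest′ , end , sides′ =
    (clear′₀ , clear′₁ , subst (λ x → Run L' (suc (suc l)) x d) (sym same-end) rest′) ,
    trans (cong (λ x → follow L' (suc (suc l)) x d) same-end) end ,
    (λ c → trans (cong₂ _+_ (trans (onLevel-τ-n c _) (cong (onLevel (suc l) c) side₀))
                            (cong₂ _+_ (trans (onLevel-τ-1+n c _) (cong (onLevel l c) side₁))
                                       (trans (cong (λ x → sides L' (suc (suc l)) x d (τ c)) same-end)
                                              (sides′ c))))
                 (swap-heads (onLevel l c (side k (pos L l)))
                             (onLevel (suc l) c (side (pass L l k) (pos L (suc l))))
                             (sides L (suc (suc l)) (pass L (suc l) (pass L l k)) d c)))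
  run-across l k (suc d) l≤n 2+n≤end (clear , run) | no l≢n
    with run-across (suc l) (pass L l k) d (ℕP.≤∧≢⇒< l≤n l≢n)
                    (subst (suc (suc n) ℕ.≤_) (ℕP.+-suc l d) 2+n≤end) run
  ... | run′ , end , sides′ rewrite pass-other {l} k l≢n (≤n⇒≢1+n l≤n) =
    (clear-other k l≢n (≤n⇒≢1+n l≤n) clear , run′) , end ,
    (λ c → cong₂ _+_ (trans (onLevel-τ-other l c _ l≢n (≤n⇒≢1+n l≤n))
                            (cong (onLevel l c) (side-other k l≢n (≤n⇒≢1+n l≤n))))
                     (sides′ c))

  run-transported : ∀ l k d → l ≢ suc n → l ℕ.+ d ≢ n → l ℕ.+ d ≢ suc n → Run L l k d → Transported l k d
  run-transported l k d l≢1+n end≢n end≢1+n run with ℕP.<-cmp (l ℕ.+ d) n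
  ... | tri< end<n _ _ = run-avoiding l k d (inj₁ (ℕP.<⇒≤ end<n)) run
  ... | tri≈ _ end≡n _ = ⊥-elim (end≢n end≡n)
  ... | tri> _ _ n<end with ℕP.≤-<-connex (suc (suc n)) l
  ...   | inj₁ 2+n≤l = run-avoiding l k d (inj₂ 2+n≤l) run
  ...   | inj₂ l<2+n = run-across l k d l≤n 2+n≤end run
    where
    l≤n : l ℕ.≤ n
    l≤n with ℕP.m≤n⇒m<n∨m≡n (ℕ.s≤s⁻¹ l<2+n)
    ... | inj₁ l<1+n = ℕ.s≤s⁻¹ l<1+n
    ... | inj₂ l≡1+n = ⊥-elim (l≢1+n l≡1+n)
    2+n≤end : suc (suc n) ℕ.≤ l ℕ.+ d
    2+n≤end with ℕP.m≤n⇒m<n∨m≡n n<end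
    ... | inj₁ 1+n<end = 1+n<end
    ... | inj₂ 1+n≡end = ⊥-elim (end≢1+n (sym 1+n≡end))

  -- Edges ending on the exchanged pair.  An edge leaving vertex n passes
  -- left of vertex n+1; after the exchange it leaves from level n+1 and
  -- skips that crossing.
  leaving-n : ∀ k d → k < h₁ → Run L (suc n) k (suc d) →
    Run L' (suc (suc n)) k d × follow L' (suc (suc n)) k d ≡ follow L (suc n) k (suc d) ×
    (∀ c → sides L (suc n) k (suc d) c ≡ onLevel (suc n) c 1ℤ + sides L' (suc (suc n)) k d (τ c))
  leaving-n k d k<h₁ (_ , rest)
    with run-avoiding (suc (suc n)) k d (inj₂ ℕP.≤-refl)
                      (subst (λ x → Run L (suc (suc n)) x d) (across-left k<h₁) rest)
  ... | rest′ , end , sides′ =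
    rest′ , trans end (cong (λ x → follow L (suc (suc n)) x d) (sym (across-left k<h₁))) ,
    (λ c → cong₂ _+_ (cong (onLevel (suc n) c) (side-left k<h₁))
                     (trans (cong (λ x → sides L (suc (suc n)) x d c) (across-left k<h₁)) (sym (sides′ c))))

  -- An edge leaving vertex n+1 now leaves vertex n (at level n) and gains a
  -- crossing right of the other vertex.
  leaving-1+n : ∀ k d → h₁ ≤ k → Run L (suc (suc n)) k d →
    Run L' (suc n) (k - o₀ + i₀) (suc d) ×
    follow L' (suc n) (k - o₀ + i₀) (suc d) ≡ follow L (suc (suc n)) k d ×
    (∀ c → sides L' (suc n) (k - o₀ + i₀) (suc d) (τ c) ≡ onLevel n c -1ℤ + sides L (suc (suc n)) k d c)
  leaving-1+n k d h₁≤k run with run-avoiding (suc (suc n)) k d (inj₂ ℕP.≤-refl) run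
  ... | run′ , end , sides′ =
    (inj₂ clear′ , subst (λ x → Run L' (suc (suc n)) x d) (sym returns) run′) ,
    trans (cong (λ x → follow L' (suc (suc n)) x d) returns) end ,
    (λ c → cong₂ _+_ (trans (onLevel-τ-1+n c _) (cong (onLevel n c) (side-right pos′≤k′)))
                     (trans (cong (λ x → sides L' (suc (suc n)) x d (τ c)) returns) (sides′ c)))
    where
    k′ = k - o₀ + i₀
    back : ∀ k o i h h₁ → (k - h₁) + (h₁ - (h + o)) ≡ k - o + i - (h + i)
    back = solve-∀
    undo : ∀ k o i → k - o + i + o - i ≡ k
    undo = solve-∀
    clear′ : pos L' (suc n) + ins L' (suc n) ≤ k′
    clear′ = subst (_≤ k′) (sym (cong₂ _+_ pos-1+n ins-1+n))
               (nonneg⇒≤ (nonneg-sum (≤⇒nonneg h₁≤k) (≤⇒nonneg admissible) (back k o₀ i₀ h₀ h₁)))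
    pos′≤k′ : pos L' (suc n) ≤ k′
    pos′≤k′ = ≤-minus-nonneg (subst NonNeg (sym ins-1+n) ins₀≥0) clear′
    returns : pass L' (suc n) k′ ≡ k
    returns = trans (across-right pos′≤k′) (trans (cong₂ (λ o i → k′ + o - i) outs-1+n ins-1+n) (undo k o₀ i₀))

  -- An edge entering vertex n passes left of it in L', where it enters the
  -- vertex one level lower.
  entering-n : ∀ l k d → l ℕ.+ d ≡ n → Run L l k d → follow L l k d < h₀ + i₀ →
    Run L' l k (suc d) × follow L' l k (suc d) ≡ follow L l k d ×
    (∀ c → sides L' l k (suc d) (τ c) ≡ sides L l k d c + onLevel (suc n) c 1ℤ)
  entering-n l k d end≡n run q<h₀+i₀ with run-avoiding l k d (inj₁ (ℕP.≤-reflexive end≡n)) run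
  ... | run′ , end , sides′ =
    run-snoc L' l k d run′ clear′ ,
    trans (follow-last L' l k d)
          (trans (cong (λ t → pass L' t (follow L' l k d)) end≡n)
                 (trans (cong (pass L' n) end) (across-left q<pos′))) ,
    (λ c → trans (sides-last L' l k d (τ c))
                 (cong₂ _+_ (sides′ c)
                   (trans (cong (λ t → onLevel t (τ c) (side (follow L' l k d) (pos L' t))) end≡n)
                     (trans (cong (λ x → onLevel n (τ c) (side x (pos L' n))) end)
                       (trans (cong (onLevel n (τ c)) (side-left q<pos′)) (onLevel-τ-n c 1ℤ))))))
    where
    q = follow L l k d
    raise : ∀ h i q h₁ o → (h + i - q - 1ℤ) + (h₁ - (h + o)) ≡ h₁ + i - o - q - 1ℤ
    raise = solve-∀
    q<pos′ : q < pos L' n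
    q<pos′ = subst (q <_) (sym pos-n)
               (nonneg⇒< (nonneg-sum (<⇒nonneg q<h₀+i₀) (≤⇒nonneg admissible) (raise h₀ i₀ q h₁ o₀)))
    clear′ : Clear L' (l ℕ.+ d) (follow L' l k d)
    clear′ = subst (λ t → Clear L' t (follow L' l k d)) (sym end≡n)
               (subst (Clear L' n) (sym end) (inj₁ q<pos′))

  -- An edge entering vertex n+1 passes right of vertex n; in L' it enters
  -- vertex n one level earlier, and that crossing disappears.
  entering-1+n : ∀ l k d → l ℕ.+ d ≡ n → Run L l k (suc d) →
    h₁ ≤ follow L l k (suc d) → follow L l k (suc d) < h₁ + i₁ →
    Run L' l k d × IsIn L' n (follow L' l k d) ×
    (∀ c → sides L' l k d (τ c) ≡ sides L l k (suc d) c + onLevel n c 1ℤ)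
  entering-1+n l k d end≡n run h₁≤r r<h₁+i₁ with run-init L l k d run
  ... | run₀ , last with run-avoiding l k d (inj₁ (ℕP.≤-reflexive end≡n)) run₀
  ... | run′ , end , sides′ = through (subst (λ t → Clear L t q) end≡n last)
    where
    q = follow L l k d
    reaches : follow L l k (suc d) ≡ pass L n q
    reaches = trans (follow-last L l k d) (cong (λ t → pass L t q) end≡n)
    last-side : ∀ c → sides L l k (suc d) c ≡ sides L l k d c + onLevel n c (side q h₀)
    last-side c = trans (sides-last L l k d c)
                        (cong (λ t → sides L l k d c + onLevel t c (side q (pos L t))) end≡n)
    through : Clear L n q → Run L' l k d × IsIn L' n (follow L' l k d) ×
              (∀ c → sides L' l k d (τ c) ≡ sides L l k (suc d) c + onLevel n c 1ℤ)
    through (inj₁ q<h₀) =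
      ⊥-elim (ℤP.<-irrefl refl (ℤP.≤-<-trans h₁≤r
        (subst (_< h₁) (sym (trans reaches (across-left q<h₀))) (left-n⇒left-1+n q<h₀))))
    through (inj₂ clear₀) =
      run′ ,
      (subst (_≤ follow L' l k d) (sym pos-n) (subst (_ ≤_) (sym end) pos′≤q) ,
       subst (follow L' l k d <_) (sym (cong₂ _+_ pos-n ins-n)) (subst (_< _) (sym end) q<pos′+ins′)) ,
      (λ c → trans (sides′ c)
               (trans (cancel _ (onLevel n c 1ℤ))
                      (cong (λ z → z + onLevel n c 1ℤ)
                            (sym (trans (last-side c)
                                        (cong (λ z → sides L l k d c + z)
                                              (trans (cong (onLevel n c) (side-right h₀≤q))
                                                     (onLevel-neg n c 1ℤ))))))))
      where
      cancel : ∀ a s → a ≡ (a + (- s)) + s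
      cancel = solve-∀
      lower : ∀ q o i h₁ → q + o - i - h₁ ≡ q - (h₁ + i - o)
      lower = solve-∀
      upper : ∀ h₁ i₁ q o i → h₁ + i₁ - (q + o - i) - 1ℤ ≡ h₁ + i - o + i₁ - q - 1ℤ
      upper = solve-∀
      h₀≤q : h₀ ≤ q
      h₀≤q = ≤-minus-nonneg ins₀≥0 clear₀
      reaches′ : follow L l k (suc d) ≡ q + o₀ - i₀
      reaches′ = trans reaches (across-right h₀≤q)
      pos′≤q : h₁ + i₀ - o₀ ≤ q
      pos′≤q = nonneg⇒≤ (subst NonNeg (lower q o₀ i₀ h₁) (≤⇒nonneg (subst (h₁ ≤_) reaches′ h₁≤r)))
      q<pos′+ins′ : q < h₁ + i₀ - o₀ + i₁
      q<pos′+ins′ = nonneg⇒< (subst NonNeg (upper h₁ i₁ q o₀ i₀) (<⇒nonneg (subst (_< h₁ + i₁) reaches′ r<h₁+i₁)))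

record Edge (L : Layout) (N x z : ℕ) : Set where
  constructor edge
  field
    wire   : ℤ
    span   : ℕ
    lands  : suc x ℕ.+ span ≡ z
    z<N    : z ℕ.< N
    output : IsOut L x wire
    route  : Run L (suc x) wire span
    input  : IsIn L z (follow L (suc x) wire span)

edgeSides : ∀ {L N x z} → Edge L N x z → ℕ → ℤ
edgeSides {L} {x = x} e = sides L (suc x) (Edge.wire e) (Edge.span e)

record TopEdge (L : Layout) (N t : ℕ) : Set where
  constructor top-edge
  field
    wire  : ℤ
    t<N   : t ℕ.< N
    route : Run L 0 wire t
    input : IsIn L t (follow L 0 wire t)

topSides : ∀ {L N t} → TopEdge L N t → ℕ → ℤ
topSides {L} {t = t} e = sides L 0 (TopEdge.wire e) t

record BottomEdge (L : Layout) (N t : ℕ) : Set where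
  constructor bottom-edge
  field
    wire   : ℤ
    span   : ℕ
    lands  : suc t ℕ.+ span ≡ N
    output : IsOut L t wire
    route  : Run L (suc t) wire span

-- A bottom edge is read upwards, hence the sign.
bottomSides : ∀ {L N t} → BottomEdge L N t → ℕ → ℤ
bottomSides {L} {t = t} e c = - sides L (suc t) (BottomEdge.wire e) (BottomEdge.span e) c

module EdgeTransport {L L' : Layout} {n N : ℕ} (X : RightExchange L L' n) (1+n<N : suc n ℕ.< N) where
  open RightExchange X
  open Transposition n
  open Unaffected X
  open Crossing X

  private
    h₀ = pos L n
    i₀ = ins L n
    o₀ = outs L n
    h₁ = pos L (suc n)
    o₁ = outs L (suc n)

    n<N : n ℕ.< N
    n<N = ℕP.<-trans (ℕP.n<1+n n) 1+n<N

    δ-values : ∀ {r C A B A′ B′ : ℤ} → A ≡ A′ → B ≡ B′ → r ≡ C + A′ - B′ → r ≡ C + A - B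
    δ-values refl refl r≡ = r≡

  -- Outputs of vertex n lie left of vertex n+1 (admissibility).
  output-n-left : ∀ {k} → IsOut L n k → k < h₁
  output-n-left {k} (_ , k<h₀+o₀) =
    nonneg⇒< (nonneg-sum (<⇒nonneg k<h₀+o₀) (≤⇒nonneg admissible) (up h₀ o₀ k h₁))
    where
    up : ∀ h o k h₁ → (h + o - k - 1ℤ) + (h₁ - (h + o)) ≡ h₁ - k - 1ℤ
    up = solve-∀

  output-n-moves : ∀ {k} → IsOut L n k → IsOut L' (suc n) k
  output-n-moves out rewrite pos-1+n | outs-1+n = out

  output-1+n-moves : ∀ {k} → IsOut L (suc n) k → IsOut L' n (k - o₀ + i₀)
  output-1+n-moves {k} (h₁≤k , k<h₁+o₁) =
    subst (_≤ k - o₀ + i₀) (sym pos-n) (nonneg⇒≤ (subst NonNeg (shift-low k o₀ i₀ h₁) (≤⇒nonneg h₁≤k))) ,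
    subst (k - o₀ + i₀ <_) (sym (cong₂ _+_ pos-n outs-n))
          (nonneg⇒< (subst NonNeg (shift-high k o₀ i₀ h₁ o₁) (<⇒nonneg k<h₁+o₁)))
    where
    shift-low : ∀ k o i h₁ → k - h₁ ≡ k - o + i - (h₁ + i - o)
    shift-low = solve-∀
    shift-high : ∀ k o i h₁ o₁ → h₁ + o₁ - k - 1ℤ ≡ h₁ + i - o + o₁ - (k - o + i) - 1ℤ
    shift-high = solve-∀

  input-n-moves : ∀ {q} → IsIn L n q → IsIn L' (suc n) q
  input-n-moves inp rewrite pos-1+n | ins-1+n = inp

  EdgeMoves : ∀ {x z} → Edge L N x z → Set
  EdgeMoves {x} {z} e =
    Σ (Edge L' N (τ x) (τ z)) λ e′ → ∀ c → edgeSides e′ (τ c) ≡ edgeSides e c + δ c z - δ c x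

  edge-from-n : ∀ {z} → Level z → (e : Edge L N n z) → EdgeMoves e
  edge-from-n (is-n refl) (edge k d lands _ _ _ _) = ⊥-elim (ℕP.m≢1+m+n n (sym lands))
  edge-from-n (is-1+n refl) (edge k zero _ _ out _ inp) =
    ⊥-elim (ℤP.<-irrefl refl (ℤP.≤-<-trans (proj₁ inp) (output-n-left out)))
  edge-from-n (is-1+n refl) (edge k (suc d) lands _ _ _ _) = ⊥-elim (ℕP.m+1+n≢m (suc n) lands)
  edge-from-n (other _ z≢1+n) (edge k zero lands _ _ _ _) =
    ⊥-elim (z≢1+n (trans (sym lands) (cong suc (ℕP.+-identityʳ n))))
  edge-from-n {z} (other z≢n z≢1+n) (edge k (suc d) lands z<N out run inp)
    with leaving-n k d (output-n-left out) run
  ... | run′ , end , sides′ rewrite τ-n | τ-other z≢n z≢1+n =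
    edge k d (trans (sym (ℕP.+-suc (suc n) d)) lands) z<N (output-n-moves out) run′
         (subst (IsIn L' z) (sym end) (in-other z≢n z≢1+n inp)) ,
    λ c → δ-values {C = sides L (suc n) k (suc d) c} (δ-other c z≢n z≢1+n) (δ-n c)
            (trans (peel (onLevel (suc n) c 1ℤ) (sides L' (suc (suc n)) k d (τ c))) (cong (λ C → C + 0ℤ - onLevel (suc n) c 1ℤ) (sym (sides′ c))))
    where
    peel : ∀ a b → b ≡ (a + b) + 0ℤ - a
    peel = solve-∀

  edge-from-1+n : ∀ {z} → Level z → (e : Edge L N (suc n) z) → EdgeMoves e
  edge-from-1+n (is-n refl) (edge k d lands _ _ _ _) =
    ⊥-elim (ℕP.m≢1+m+n n (trans (sym lands) (cong suc (sym (ℕP.+-suc n d)))))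
  edge-from-1+n (is-1+n refl) (edge k d lands _ _ _ _) = ⊥-elim (ℕP.m≢1+m+n (suc n) (sym lands))
  edge-from-1+n {z} (other z≢n z≢1+n) (edge k d lands z<N out run inp)
    with leaving-1+n k d (proj₁ out) run
  ... | run′ , end , sides′ rewrite τ-1+n | τ-other z≢n z≢1+n =
    edge (k - o₀ + i₀) (suc d) (trans (ℕP.+-suc (suc n) d) lands) z<N (output-1+n-moves out) run′
         (subst (IsIn L' z) (sym end) (in-other z≢n z≢1+n inp)) ,
    λ c → trans (sides′ c)
            (trans (cong (λ u → u + sides L (suc (suc n)) k d c) (onLevel-neg n c 1ℤ))
                   (δ-values {C = sides L (suc (suc n)) k d c} (δ-other c z≢n z≢1+n) (δ-1+n c)
                             (rotate (onLevel n c 1ℤ) (sides L (suc (suc n)) k d c))))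
    where
    rotate : ∀ a b → - a + b ≡ b + 0ℤ - a
    rotate = solve-∀

  edge-from-other : ∀ {x z} → x ≢ n → x ≢ suc n → Level z → (e : Edge L N x z) → EdgeMoves e
  edge-from-other {x} x≢n x≢1+n (is-n refl) (edge k d lands _ out run inp)
    with entering-n (suc x) k d lands run (proj₂ inp)
  ... | run′ , end , sides′ rewrite τ-other x≢n x≢1+n | τ-n =
    edge k (suc d) (trans (ℕP.+-suc (suc x) d) (cong suc lands)) 1+n<N (out-other x≢n x≢1+n out) run′
         (subst (IsIn L' (suc n)) (sym end) (input-n-moves inp)) ,
    λ c → trans (sides′ c) (δ-values {C = sides L (suc x) k d c} (δ-n c) (δ-other c x≢n x≢1+n)
                                     (minus0 (onLevel (suc n) c 1ℤ) (sides L (suc x) k d c)))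
    where
    minus0 : ∀ a b → b + a ≡ b + a - 0ℤ
    minus0 = solve-∀
  edge-from-other {x} x≢n _ (is-1+n refl) (edge k zero lands _ _ _ _) =
    ⊥-elim (x≢n (ℕP.suc-injective (trans (cong suc (sym (ℕP.+-identityʳ x))) lands)))
  edge-from-other {x} x≢n x≢1+n (is-1+n refl) (edge k (suc d) lands _ out run inp)
    with entering-1+n (suc x) k d (ℕP.suc-injective (trans (sym (ℕP.+-suc (suc x) d)) lands))
                      run (proj₁ inp) (proj₂ inp)
  ... | run′ , inp′ , sides′ rewrite τ-other x≢n x≢1+n | τ-1+n =
    edge k d (ℕP.suc-injective (trans (sym (ℕP.+-suc (suc x) d)) lands)) n<N (out-other x≢n x≢1+n out) run′ inp′ ,
    λ c → trans (sides′ c) (δ-values {C = sides L (suc x) k (suc d) c} (δ-1+n c) (δ-other c x≢n x≢1+n)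
                                     (minus0 (onLevel n c 1ℤ) (sides L (suc x) k (suc d) c)))
    where
    minus0 : ∀ a b → b + a ≡ b + a - 0ℤ
    minus0 = solve-∀
  edge-from-other {x} {z} x≢n x≢1+n (other z≢n z≢1+n) (edge k d lands z<N out run inp)
    with run-transported (suc x) k d (x≢n ∘ ℕP.suc-injective)
                         (z≢n ∘ trans (sym lands)) (z≢1+n ∘ trans (sym lands)) run
  ... | run′ , end , sides′ rewrite τ-other x≢n x≢1+n | τ-other z≢n z≢1+n =
    edge k d lands z<N (out-other x≢n x≢1+n out) run′ (subst (IsIn L' z) (sym end) (in-other z≢n z≢1+n inp)) ,
    λ c → trans (sides′ c) (δ-values {C = sides L (suc x) k d c} (δ-other c z≢n z≢1+n) (δ-other c x≢n x≢1+n)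
                                     (plus0minus0 (sides L (suc x) k d c)))
    where
    plus0minus0 : ∀ b → b ≡ b + 0ℤ - 0ℤ
    plus0minus0 = solve-∀

  edge-moves : ∀ {x z} (e : Edge L N x z) → EdgeMoves e
  edge-moves {x} {z} e with level x
  ... | is-n refl = edge-from-n (level z) e
  ... | is-1+n refl = edge-from-1+n (level z) e
  ... | other x≢n x≢1+n = edge-from-other x≢n x≢1+n (level z) e

  top-edge-moves : ∀ {t} → Level t → (e : TopEdge L N t) →
    Σ (TopEdge L' N (τ t)) λ e′ → ∀ c → topSides e′ (τ c) ≡ topSides e c + δ c t
  top-edge-moves (is-n refl) (top-edge k _ run inp) with entering-n 0 k n refl run (proj₂ inp)
  ... | run′ , end , sides′ rewrite τ-n =
    top-edge k 1+n<N run′ (subst (IsIn L' (suc n)) (sym end) (input-n-moves inp)) ,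
    λ c → trans (sides′ c) (cong (λ u → sides L 0 k n c + u) (sym (δ-n c)))
  top-edge-moves (is-1+n refl) (top-edge k _ run inp) with entering-1+n 0 k n refl run (proj₁ inp) (proj₂ inp)
  ... | run′ , inp′ , sides′ rewrite τ-1+n =
    top-edge k n<N run′ inp′ ,
    λ c → trans (sides′ c) (cong (λ u → sides L 0 k (suc n) c + u) (sym (δ-1+n c)))
  top-edge-moves {t} (other t≢n t≢1+n) (top-edge k t<N run inp)
    with run-transported 0 k t (λ ()) t≢n t≢1+n run
  ... | run′ , end , sides′ rewrite τ-other t≢n t≢1+n =
    top-edge k t<N run′ (subst (IsIn L' t) (sym end) (in-other t≢n t≢1+n inp)) ,
    λ c → trans (sides′ c) (sym (trans (cong (λ u → sides L 0 k t c + u) (δ-other c t≢n t≢1+n)) (ℤP.+-identityʳ _)))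

  bottom-edge-moves : ∀ {t} → Level t → (e : BottomEdge L N t) →
    Σ (BottomEdge L' N (τ t)) λ e′ → ∀ c → bottomSides e′ (τ c) ≡ bottomSides e c + δ c t
  bottom-edge-moves (is-n refl) (bottom-edge k zero lands _ _) =
    ⊥-elim (ℕP.<-irrefl (trans (sym (ℕP.+-identityʳ (suc n))) lands) 1+n<N)
  bottom-edge-moves (is-n refl) (bottom-edge k (suc d) lands out run)
    with leaving-n k d (output-n-left out) run
  ... | run′ , _ , sides′ rewrite τ-n =
    bottom-edge k d (trans (sym (ℕP.+-suc (suc n) d)) lands) (output-n-moves out) run′ ,
    λ c → trans (negate (onLevel (suc n) c 1ℤ) (sides L' (suc (suc n)) k d (τ c)))
                (sym (cong₂ _+_ (cong -_ (sides′ c)) (δ-n c)))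
    where
    negate : ∀ a b → - b ≡ - (a + b) + a
    negate = solve-∀
  bottom-edge-moves (is-1+n refl) (bottom-edge k d lands out run)
    with leaving-1+n k d (proj₁ out) run
  ... | run′ , _ , sides′ rewrite τ-1+n =
    bottom-edge (k - o₀ + i₀) (suc d) (trans (ℕP.+-suc (suc n) d) lands) (output-1+n-moves out) run′ ,
    λ c → trans (cong -_ (trans (sides′ c) (cong (λ u → u + sides L (suc (suc n)) k d c) (onLevel-neg n c 1ℤ))))
                (trans (negate (onLevel n c 1ℤ) (sides L (suc (suc n)) k d c))
                       (cong (λ u → - sides L (suc (suc n)) k d c + u) (sym (δ-1+n c))))
    where
    negate : ∀ a b → - (- a + b) ≡ - b + a
    negate = solve-∀
  bottom-edge-moves {t} (other t≢n t≢1+n) (bottom-edge k d lands out run)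
    with run-transported (suc t) k d (t≢n ∘ ℕP.suc-injective)
                         (λ end≡n → ℕP.<-irrefl (trans (sym end≡n) lands) n<N)
                         (λ end≡1+n → ℕP.<-irrefl (trans (sym end≡1+n) lands) 1+n<N) run
  ... | run′ , _ , sides′ rewrite τ-other t≢n t≢1+n =
    bottom-edge k d lands (out-other t≢n t≢1+n out) run′ ,
    λ c → trans (cong -_ (sides′ c))
                (trans (sym (ℤP.+-identityʳ _)) (cong (λ u → - sides L (suc t) k d c + u) (sym (δ-other c t≢n t≢1+n))))

-- A link from a to b is an edge traversed in
-- either direction; its sides are counted along the direction of travel.

Link : Layout → ℕ → ℕ → ℕ → Set
Link L N a b = Edge L N a b ⊎ Edge L N b a

Walk : Layout → ℕ → ℕ → ℕ → Set
Walk L N = Star (Link L N)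

linkSides : ∀ {L N a b} → Link L N a b → ℕ → ℤ
linkSides (inj₁ e) c = edgeSides e c
linkSides (inj₂ e) c = - edgeSides e c

walkSides : ∀ {L N a b} → Walk L N a b → ℕ → ℤ
walkSides ε c = 0ℤ
walkSides (s ◅ w) c = linkSides s c + walkSides w c

walkLength : ∀ {L N a b} → Walk L N a b → ℕ
walkLength ε = 0
walkLength (_ ◅ w) = suc (walkLength w)

data Anchor (L : Layout) (N b : ℕ) : ℕ → Set where
  self   : Anchor L N b b
  top    : ∀ {t} → TopEdge L N t → Anchor L N b t
  bottom : ∀ {t} → BottomEdge L N t → Anchor L N b t

anchorSides : ∀ {L N b t} → Anchor L N b t → ℤ
anchorSides self = 0ℤ
anchorSides {b = b} (top e) = topSides e b
anchorSides {b = b} (bottom e) = bottomSides e b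

Witness : Layout → ℕ → ℕ → ℕ → Set
Witness L N a b = Σ ℕ λ t → Anchor L N b t × Walk L N t a

weight : ∀ {L N a b} → Witness L N a b → ℤ
weight {b = b} (_ , anchor , w) = anchorSides anchor + walkSides w b

witnessLength : ∀ {L N a b} → Witness L N a b → ℕ
witnessLength (_ , _ , w) = walkLength w

slack : ∀ {L N a b} → Witness L N a b → ℤ
slack w = + suc (witnessLength w) - weight w

-- Each edge contributes at most 1 to a weight, so slacks are nonnegative.

private
  negate-bound : ∀ x → 1ℤ + x ≡ 1ℤ - - x
  negate-bound = solve-∀
  collect : ∀ m a q → (1ℤ - a) + (m - q) ≡ (1ℤ + m) - (a + q)
  collect = solve-∀

linkSides-bounded : ∀ {L N a b} (s : Link L N a b) c → NonNeg (1ℤ - linkSides s c)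
linkSides-bounded {L} {a = a} (inj₁ e) c = proj₁ (sides-bounded L (suc a) (Edge.wire e) (Edge.span e) c)
linkSides-bounded {L} {b = b} (inj₂ e) c =
  subst NonNeg (negate-bound (edgeSides e c)) (proj₂ (sides-bounded L (suc b) (Edge.wire e) (Edge.span e) c))

walkSides-bounded : ∀ {L N a b} (w : Walk L N a b) c → NonNeg (+ walkLength w - walkSides w c)
walkSides-bounded ε c = nonneg-ℕ 0
walkSides-bounded (s ◅ w) c =
  nonneg-sum (linkSides-bounded s c) (walkSides-bounded w c) (collect (+ walkLength w) (linkSides s c) (walkSides w c))

anchorSides-bounded : ∀ {L N b t} (anchor : Anchor L N b t) → NonNeg (1ℤ - anchorSides anchor)
anchorSides-bounded self = nonneg-ℕ 1
anchorSides-bounded {L} {b = b} {t} (top e) = proj₁ (sides-bounded L 0 (TopEdge.wire e) t b)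
anchorSides-bounded {L} {b = b} {t} (bottom e) =
  subst NonNeg (negate-bound (sides L (suc t) (BottomEdge.wire e) (BottomEdge.span e) b))
        (proj₂ (sides-bounded L (suc t) (BottomEdge.wire e) (BottomEdge.span e) b))

slack-nonneg : ∀ {L N a b} (w : Witness L N a b) → NonNeg (slack w)
slack-nonneg {b = b} (_ , anchor , w) =
  nonneg-sum (anchorSides-bounded anchor) (walkSides-bounded w b)
             (collect (+ walkLength w) (anchorSides anchor) (walkSides w b))

-- Along a right exchange, witnesses move with their vertices: a witness for
-- (τ a, τ b) becomes one for (a, b) of the same length whose weight grows by
-- δ (τ b) (τ a), since all intermediate crossings telescope away.
module WitnessTransport {L L' : Layout} {n N : ℕ} (X : RightExchange L L' n) (1+n<N : suc n ℕ.< N) where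
  open Transposition n
  open EdgeTransport X 1+n<N

  link-moves : ∀ {a b} (s : Link L N a b) →
    Σ (Link L' N (τ a) (τ b)) λ s′ → ∀ c → linkSides s′ (τ c) ≡ linkSides s c + δ c b - δ c a
  link-moves (inj₁ e) with edge-moves e
  ... | e′ , sides′ = inj₁ e′ , sides′
  link-moves {a} {b} (inj₂ e) with edge-moves e
  ... | e′ , sides′ = inj₂ e′ , λ c → trans (cong -_ (sides′ c)) (flip (edgeSides e c) (δ c a) (δ c b))
    where
    flip : ∀ s x y → - (s + x - y) ≡ - s + y - x
    flip = solve-∀

  walk-moves : ∀ {a b} (w : Walk L N a b) →
    Σ (Walk L' N (τ a) (τ b)) λ w′ →
      walkLength w′ ≡ walkLength w × (∀ c → walkSides w′ (τ c) ≡ walkSides w c + δ c b - δ c a)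
  walk-moves {a} ε = ε , refl , λ c → empty (δ c a)
    where
    empty : ∀ x → 0ℤ ≡ 0ℤ + x - x
    empty = solve-∀
  walk-moves {a} {b} (_◅_ {j = m} s w) with link-moves s | walk-moves w
  ... | s′ , sides-s | w′ , len , sides-w =
    s′ ◅ w′ , cong suc len ,
    λ c → trans (cong₂ _+_ (sides-s c) (sides-w c))
                (telescope (linkSides s c) (walkSides w c) (δ c m) (δ c a) (δ c b))
    where
    telescope : ∀ S W m a b → (S + m - a) + (W + b - m) ≡ (S + W) + b - a
    telescope = solve-∀

  anchor-moves : ∀ {b t} (anchor : Anchor L N b t) →
    Σ (Anchor L' N (τ b) (τ t)) λ anchor′ → anchorSides anchor′ ≡ anchorSides anchor + δ b t
  anchor-moves {b} self = self , sym (trans (ℤP.+-identityˡ _) (δ-diagonal b))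
  anchor-moves {t = t} (top e) with top-edge-moves (level t) e
  ... | e′ , sides′ = top e′ , sides′ _
  anchor-moves {t = t} (bottom e) with bottom-edge-moves (level t) e
  ... | e′ , sides′ = bottom e′ , sides′ _

  witness-moves : ∀ {a b} (w : Witness L N a b) →
    Σ (Witness L' N (τ a) (τ b)) λ w′ → witnessLength w′ ≡ witnessLength w × weight w′ ≡ weight w + δ b a
  witness-moves {a} {b} (t , anchor , w) with anchor-moves anchor | walk-moves w
  ... | anchor′ , sides-anchor | w′ , len , sides-w =
    (τ t , anchor′ , w′) , len ,
    trans (cong₂ _+_ sides-anchor (sides-w b))
          (telescope (anchorSides anchor) (δ b t) (walkSides w b) (δ b a))
    where
    telescope : ∀ S T W A → (S + T) + (W + A - T) ≡ (S + W) + A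
    telescope = solve-∀

  slack-subst : ∀ {M a b a′ b′} (a≡ : a ≡ a′) (b≡ : b ≡ b′) (w : Witness L' M a b) →
    slack (subst₂ (Witness L' M) a≡ b≡ w) ≡ slack w
  slack-subst refl refl w = refl

  witness-pulled-back : ∀ a b (w : Witness L N (τ a) (τ b)) →
    Σ (Witness L' N a b) λ w′ → slack w′ ≡ slack w - δ (τ b) (τ a)
  witness-pulled-back a b w with witness-moves w
  ... | w′ , len , weight′ =
    subst₂ (Witness L' N) (τ-involutive a) (τ-involutive b) w′ ,
    trans (slack-subst (τ-involutive a) (τ-involutive b) w′)
          (trans (cong₂ (λ l x → + suc l - x) len weight′)
                 (split (+ suc (witnessLength w)) (weight w) (δ (τ b) (τ a))))
    where
    split : ∀ A W d → A - (W + d) ≡ (A - W) - d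
    split = solve-∀

-- From diagrams to layouts.  A diagram is read as the layout of its values
-- at each height (0 beyond the last vertex, where nothing is ever looked up).

layoutOf : Diagram → Layout
layoutOf D = layout (λ t → + at (H D) t) (λ t → + at (I D) t) (λ t → + at (O D) t)

vertexData : Diagram → ℕ → ℕ × ℕ × ℕ
vertexData D t = at (H D) t , at (I D) t , at (O D) t

vertexData-inside : ∀ D t (t<N : t ℕ.< N D) →
  vertexData D t ≡ (H D (fromℕ< t<N) , I D (fromℕ< t<N) , O D (fromℕ< t<N))
vertexData-inside D t t<N with t ℕ.<? N D
... | yes _ = refl
... | no t≮N = ⊥-elim (t≮N t<N)

at-toℕ : ∀ {N} (f : Fin N → ℕ) (a : Fin N) → at f (toℕ a) ≡ f a
at-toℕ {N} f a with toℕ a ℕ.<? N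
... | yes _ = cong f (FinP.fromℕ<-toℕ a _)
... | no a≮N = ⊥-elim (a≮N (FinP.toℕ<n a))

module DiagramExchange (D : Diagram) (n : ℕ) (p : suc n ℕ.< N D) where
  open Transposition n using (n≢1+n)

  D′ = rightExchange D n p

  n<N : n ℕ.< N D
  n<N = ℕP.<-trans (ℕP.n<1+n n) p

  vₙ vₙ₊₁ : Fin (N D)
  vₙ = fromℕ< n<N
  vₙ₊₁ = fromℕ< p

  data Slot (m : Fin (N D)) : ℕ × ℕ × ℕ → Set where
    slot-n     : toℕ m ≡ n → Slot m (H D vₙ₊₁ ℕ.+ I D vₙ ℕ.∸ O D vₙ , I D vₙ₊₁ , O D vₙ₊₁)
    slot-1+n   : toℕ m ≡ suc n → Slot m (H D vₙ , I D vₙ , O D vₙ)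
    slot-other : toℕ m ≢ n → toℕ m ≢ suc n → Slot m (H D m , I D m , O D m)

  slot : ∀ m → Slot m (H D′ m , I D′ m , O D′ m)
  slot m with toℕ m ≟ n
  ... | yes m≡n = slot-n m≡n
  ... | no m≢n with toℕ m ≟ suc n
  ...   | yes m≡1+n = slot-1+n m≡1+n
  ...   | no m≢1+n = slot-other m≢n m≢1+n

  data-n : vertexData D′ n ≡ (H D vₙ₊₁ ℕ.+ I D vₙ ℕ.∸ O D vₙ , I D vₙ₊₁ , O D vₙ₊₁)
  data-n = trans (vertexData-inside D′ n n<N) (from-slot (slot vₙ))
    where
    from-slot : ∀ {v} → Slot vₙ v → v ≡ (H D vₙ₊₁ ℕ.+ I D vₙ ℕ.∸ O D vₙ , I D vₙ₊₁ , O D vₙ₊₁)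
    from-slot (slot-n _) = refl
    from-slot (slot-1+n e) = ⊥-elim (n≢1+n (trans (sym (FinP.toℕ-fromℕ< n<N)) e))
    from-slot (slot-other n≢n _) = ⊥-elim (n≢n (FinP.toℕ-fromℕ< n<N))

  data-1+n : vertexData D′ (suc n) ≡ (H D vₙ , I D vₙ , O D vₙ)
  data-1+n = trans (vertexData-inside D′ (suc n) p) (from-slot (slot vₙ₊₁))
    where
    from-slot : ∀ {v} → Slot vₙ₊₁ v → v ≡ (H D vₙ , I D vₙ , O D vₙ)
    from-slot (slot-n e) = ⊥-elim (ℕP.1+n≢n (trans (sym (FinP.toℕ-fromℕ< p)) e))
    from-slot (slot-1+n _) = refl
    from-slot (slot-other _ 1+n≢1+n) = ⊥-elim (1+n≢1+n (FinP.toℕ-fromℕ< p))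

  data-other : ∀ t → t ≢ n → t ≢ suc n → vertexData D′ t ≡ vertexData D t
  data-other t t≢n t≢1+n with t ℕ.<? N D
  ... | no _ = refl
  ... | yes t<N = from-slot (slot (fromℕ< t<N))
    where
    m = fromℕ< t<N
    from-slot : ∀ {v} → Slot m v → v ≡ (H D m , I D m , O D m)
    from-slot (slot-n e) = ⊥-elim (t≢n (trans (sym (FinP.toℕ-fromℕ< t<N)) e))
    from-slot (slot-1+n e) = ⊥-elim (t≢1+n (trans (sym (FinP.toℕ-fromℕ< t<N)) e))
    from-slot (slot-other _ _) = refl

  module _ (admissible : RightAdmissible D n p) where
    private
      hₙ = cong proj₁ (vertexData-inside D n n<N)
      iₙ = cong (proj₁ ∘ proj₂) (vertexData-inside D n n<N)
      oₙ = cong (proj₂ ∘ proj₂) (vertexData-inside D n n<N)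
      hₙ₊₁ = cong proj₁ (vertexData-inside D (suc n) p)
      iₙ₊₁ = cong (proj₁ ∘ proj₂) (vertexData-inside D (suc n) p)
      oₙ₊₁ = cong (proj₂ ∘ proj₂) (vertexData-inside D (suc n) p)

      -- The new offset H(n+1) + I(n) - O(n) is computed without truncation.
      new-offset : + (H D vₙ₊₁ ℕ.+ I D vₙ ℕ.∸ O D vₙ) ≡ + at (H D) (suc n) + + at (I D) n - + at (O D) n
      new-offset = begin
        + (H D vₙ₊₁ ℕ.+ I D vₙ ℕ.∸ O D vₙ)   ≡⟨ +-∸ _ _ outputs-fit ⟩
        + H D vₙ₊₁ + + I D vₙ - + O D vₙ    ≡⟨ cong₂ (λ h i → + h + + i - + O D vₙ) (sym hₙ₊₁) (sym iₙ) ⟩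
        + at (H D) (suc n) + + at (I D) n - + O D vₙ ≡⟨ cong (λ o → + at (H D) (suc n) + + at (I D) n - + o) (sym oₙ) ⟩
        + at (H D) (suc n) + + at (I D) n - + at (O D) n ∎
        where
        open ≡-Reasoning
        outputs-fit : O D vₙ ℕ.≤ H D vₙ₊₁ ℕ.+ I D vₙ
        outputs-fit = ℕP.≤-trans (ℕP.m≤n+m (O D vₙ) (H D vₙ)) (ℕP.≤-trans admissible (ℕP.m≤m+n (H D vₙ₊₁) (I D vₙ)))

    exchange : RightExchange (layoutOf D) (layoutOf D′) n
    exchange = record
      { admissible = ℤ.+≤+ (subst₂ ℕ._≤_ (sym (cong₂ ℕ._+_ hₙ oₙ)) (sym hₙ₊₁) admissible)
      ; ins₀≥0 = nonneg-ℕ _ ; outs₀≥0 = nonneg-ℕ _ ; ins₁≥0 = nonneg-ℕ _ ; outs₁≥0 = nonneg-ℕ _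
      ; pos-n = trans (cong (+_ ∘ proj₁) data-n) new-offset
      ; ins-n = cong +_ (trans (cong (proj₁ ∘ proj₂) data-n) (sym iₙ₊₁))
      ; outs-n = cong +_ (trans (cong (proj₂ ∘ proj₂) data-n) (sym oₙ₊₁))
      ; pos-1+n = cong +_ (trans (cong proj₁ data-1+n) (sym hₙ))
      ; ins-1+n = cong +_ (trans (cong (proj₁ ∘ proj₂) data-1+n) (sym iₙ))
      ; outs-1+n = cong +_ (trans (cong (proj₂ ∘ proj₂) data-1+n) (sym oₙ))
      ; pos-other = λ t t≢n t≢1+n → cong (+_ ∘ proj₁) (data-other t t≢n t≢1+n)
      ; ins-other = λ t t≢n t≢1+n → cong (+_ ∘ proj₁ ∘ proj₂) (data-other t t≢n t≢1+n)
      ; outs-other = λ t t≢n t≢1+n → cong (+_ ∘ proj₂ ∘ proj₂) (data-other t t≢n t≢1+n)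
      }

module DiagramGraph (D : Diagram) where
  private
    L = layoutOf D

  continue⇒pass : ∀ {m j j′} → Cont D m j j′ → Clear L m (+ j) × pass L m (+ j) ≡ + j′
  continue⇒pass {m} (_ , _ , inj₁ (j<h , j′≡j)) =
    inj₁ (ℤ.+<+ j<h) , trans (across-left {+ at (H D) m} {+ at (I D) m} {+ at (O D) m} (ℤ.+<+ j<h)) (cong +_ (sym j′≡j))
  continue⇒pass {m} {j} (_ , _ , inj₂ (h+i≤j , j′≡)) =
    inj₂ (ℤ.+≤+ h+i≤j) ,
    trans (across-right {+ at (H D) m} {+ at (I D) m} {+ at (O D) m} (ℤ.+≤+ (ℕP.≤-trans (ℕP.m≤m+n _ _) h+i≤j)))
          (trans (sym (+-∸ (j ℕ.+ at (O D) m) (at (I D) m) i≤j+o)) (cong +_ (sym j′≡)))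
    where
    i≤j+o : at (I D) m ℕ.≤ j ℕ.+ at (O D) m
    i≤j+o = ℕP.≤-trans (ℕP.≤-trans (ℕP.m≤n+m _ _) h+i≤j) (ℕP.m≤m+n j _)

  reach⇒run : ∀ {l k m j} → Reach D l k m j →
    Σ ℕ λ d → (l ℕ.+ d ≡ m) × Run L l (+ k) d × follow L l (+ k) d ≡ + j
  reach⇒run {l} here = 0 , ℕP.+-identityʳ l , tt , refl
  reach⇒run {l} {k} (step reach cont) with reach⇒run reach | continue⇒pass cont
  ... | d , l+d≡m , run , end | clear , passes =
    suc d , trans (ℕP.+-suc l d) (cong suc l+d≡m) ,
    run-snoc L l (+ k) d run (subst₂ (Clear L) (sym l+d≡m) (sym end) clear) ,
    trans (follow-last L l (+ k) d) (trans (cong₂ (pass L) l+d≡m end) passes)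

  output⇒ : ∀ {a k} → IsOutput D a k → IsOut L (toℕ a) (+ k)
  output⇒ {a} (h≤k , k<h+o) rewrite at-toℕ (H D) a | at-toℕ (O D) a = ℤ.+≤+ h≤k , ℤ.+<+ k<h+o

  input⇒ : ∀ {a k} → IsInput D a k → IsIn L (toℕ a) (+ k)
  input⇒ {a} (h≤k , k<h+i) rewrite at-toℕ (H D) a | at-toℕ (I D) a = ℤ.+≤+ h≤k , ℤ.+<+ k<h+i

  edge⇒ : ∀ {a b} → EdgeDown D a b → Edge L (N D) (toℕ a) (toℕ b)
  edge⇒ {a} {b} (k , _ , out , reach , inp) with reach⇒run reach
  ... | d , lands , run , end =
    edge (+ k) d lands (FinP.toℕ<n b) (output⇒ out) run (subst (IsIn L (toℕ b)) (sym end) (input⇒ inp))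

  link⇒ : ∀ {a b} → Adj D a b → Link L (N D) (toℕ a) (toℕ b)
  link⇒ (inj₁ e) = inj₁ (edge⇒ e)
  link⇒ (inj₂ e) = inj₂ (edge⇒ e)

  walk⇒ : ∀ {a b} → Path D a b → Walk L (N D) (toℕ a) (toℕ b)
  walk⇒ = gmap toℕ link⇒

  walk-reverse : ∀ {a b} → Walk L (N D) a b → Walk L (N D) b a
  walk-reverse = reverse ⊎-swap

  anchor⇒ : ∀ {b t} → TouchesBoundary D t → Anchor L (N D) b (toℕ t)
  anchor⇒ {t = t} (inj₁ (k , _ , _ , reach , inp)) with reach⇒run reach
  ... | d , d≡t , run , end =
    top (top-edge (+ k) (FinP.toℕ<n t) (subst (Run L 0 (+ k)) d≡t run)
                  (subst (IsIn L (toℕ t)) (sym (trans (cong (follow L 0 (+ k)) (sym d≡t)) end)) (input⇒ inp)))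
  anchor⇒ (inj₂ (k , _ , out , reach)) with reach⇒run reach
  ... | d , lands , run , _ = bottom (bottom-edge (+ k) d lands (output⇒ out) run)

  -- Every pair of vertices has a witness: either a path from b to a, or a
  -- path from a to a vertex touching the boundary, read backwards.
  witness⇒ : BoundaryConnected D → ∀ a b → a ℕ.< N D → b ℕ.< N D → Witness L (N D) a b
  witness⇒ (inj₁ connected) a b a<N b<N =
    b , self , subst₂ (Walk L (N D)) (FinP.toℕ-fromℕ< b<N) (FinP.toℕ-fromℕ< a<N)
                      (walk⇒ (connected (fromℕ< b<N) (fromℕ< a<N)))
  witness⇒ (inj₂ reaches-boundary) a b a<N b<N with reaches-boundary (fromℕ< a<N)
  ... | t , path , touches =
    toℕ t , anchor⇒ touches , subst (Walk L (N D) (toℕ t)) (FinP.toℕ-fromℕ< a<N) (walk-reverse (walk⇒ path))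

sumBelow : (ℕ → ℤ) → ℕ → ℤ
sumBelow f zero = 0ℤ
sumBelow f (suc m) = sumBelow f m + f m

doubleSum : (ℕ → ℕ → ℤ) → ℕ → ℤ
doubleSum g m = sumBelow (λ a → sumBelow (g a) m) m

sum-cong : ∀ {f g} m → (∀ a → a ℕ.< m → f a ≡ g a) → sumBelow f m ≡ sumBelow g m
sum-cong zero _ = refl
sum-cong (suc m) f≡g = cong₂ _+_ (sum-cong m (λ a a<m → f≡g a (ℕP.m≤n⇒m≤1+n a<m))) (f≡g m (ℕP.n<1+n m))

sum-nonneg : ∀ {f} m → (∀ a → a ℕ.< m → NonNeg (f a)) → NonNeg (sumBelow f m)
sum-nonneg zero _ = nonneg-ℕ 0
sum-nonneg (suc m) f≥0 =
  ℤP.+-mono-≤ (sum-nonneg m (λ a a<m → f≥0 a (ℕP.m≤n⇒m≤1+n a<m))) (f≥0 m (ℕP.n<1+n m))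

sum-minus : ∀ f g m → sumBelow (λ a → f a - g a) m ≡ sumBelow f m - sumBelow g m
sum-minus f g zero = refl
sum-minus f g (suc m) =
  trans (cong (λ u → u + (f m - g m)) (sum-minus f g m)) (regroup (sumBelow f m) (sumBelow g m) (f m) (g m))
  where
  regroup : ∀ a b c d → (a - b) + (c - d) ≡ (a + c) - (b + d)
  regroup = solve-∀

sum-dominates : ∀ {f} m → (∀ a → a ℕ.< m → NonNeg (f a)) → ∀ a₀ → a₀ ℕ.< m → NonNeg (sumBelow f m - f a₀)
sum-dominates {f} (suc m) f≥0 a₀ a₀<1+m with ℕP.m≤n⇒m<n∨m≡n (ℕ.s≤s⁻¹ a₀<1+m)
... | inj₂ refl = subst NonNeg (cancel (sumBelow f m) (f a₀)) (sum-nonneg m (λ a a<m → f≥0 a (ℕP.m≤n⇒m≤1+n a<m)))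
  where
  cancel : ∀ a b → a ≡ a + b - b
  cancel = solve-∀
... | inj₁ a₀<m =
  nonneg-sum (sum-dominates m (λ a a<m → f≥0 a (ℕP.m≤n⇒m≤1+n a<m)) a₀ a₀<m) (f≥0 m (ℕP.n<1+n m))
             (regroup (sumBelow f m) (f a₀) (f m))
  where
  regroup : ∀ a b c → (a - b) + c ≡ a + c - b
  regroup = solve-∀

module TransposedSums (n m : ℕ) (1+n<m : suc n ℕ.< m) where
  open Transposition n

  sum-τ : ∀ f → sumBelow (f ∘ τ) m ≡ sumBelow f m
  sum-τ f = subst (λ x → sumBelow (f ∘ τ) x ≡ sumBelow f x) (ℕP.m∸n+n≡m 1+n<m) (beyond (m ℕ.∸ suc (suc n)))
    where
    below : ∀ k → k ℕ.≤ n → sumBelow (f ∘ τ) k ≡ sumBelow f k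
    below zero _ = refl
    below (suc k) 1+k≤n =
      cong₂ _+_ (below k (ℕP.≤-trans (ℕP.n≤1+n k) 1+k≤n))
                (cong f (τ-other (ℕP.<⇒≢ 1+k≤n) (ℕP.<⇒≢ (ℕP.m≤n⇒m≤1+n 1+k≤n))))
    both : sumBelow (f ∘ τ) (suc (suc n)) ≡ sumBelow f (suc (suc n))
    both = trans (cong₂ _+_ (cong₂ _+_ (below n ℕP.≤-refl) (cong f τ-n)) (cong f τ-1+n))
                 (swap-last (sumBelow f n) (f n) (f (suc n)))
      where
      swap-last : ∀ a b c → a + c + b ≡ a + b + c
      swap-last = solve-∀
    beyond : ∀ d → sumBelow (f ∘ τ) (d ℕ.+ suc (suc n)) ≡ sumBelow f (d ℕ.+ suc (suc n))
    beyond zero = both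
    beyond (suc d) = cong₂ _+_ (beyond d) (cong f (τ-other (ℕP.>⇒≢ n<t) (ℕP.>⇒≢ 1+n<t)))
      where
      1+n<t : suc n ℕ.< d ℕ.+ suc (suc n)
      1+n<t = ℕP.m≤n+m (suc (suc n)) d
      n<t : n ℕ.< d ℕ.+ suc (suc n)
      n<t = ℕP.<-trans (ℕP.n<1+n n) 1+n<t

  doubleSum-relabel : ∀ g → doubleSum (λ a b → g (τ a) (τ b) - δ (τ b) (τ a)) m
                            ≡ doubleSum g m - doubleSum (λ a b → δ b a) m
  doubleSum-relabel g =
    trans (sum-cong m (λ a _ → sum-minus (λ b → g (τ a) (τ b)) (λ b → δ (τ b) (τ a)) m))
      (trans (sum-minus (λ a → sumBelow (λ b → g (τ a) (τ b)) m) (λ a → sumBelow (λ b → δ (τ b) (τ a)) m) m)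
        (cong₂ _-_
          (trans (sum-cong m (λ a _ → sum-τ (g (τ a)))) (sum-τ (λ a → sumBelow (g a) m)))
          (trans (sum-cong m (λ a _ → sum-τ (λ b → δ b (τ a)))) (sum-τ (λ a → sumBelow (λ b → δ b a) m)))))

  -- The pair (n, n+1) contributes a crossing, so the total is at least 1.
  crossings-positive : NonNeg (doubleSum (λ a b → δ b a) m - 1ℤ)
  crossings-positive =
    subst NonNeg (cong (λ u → total - u) (trans (δ-n (suc n)) (onLevel-same (suc n) 1ℤ)))
      (nonneg-sum (sum-dominates m (λ a _ → sum-nonneg m (λ b _ → δ-nonneg b a)) n n<m)
                  (sum-dominates m (λ b _ → δ-nonneg b n) (suc n) 1+n<m)
                  (chain total (sumBelow (λ b → δ b n) m) (δ (suc n) n)))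
    where
    total = doubleSum (λ a b → δ b a) m
    n<m = ℕP.<-trans (ℕP.n<1+n n) 1+n<m
    chain : ∀ A B C → (A - B) + (B - C) ≡ A - C
    chain = solve-∀

no-infinite-descent : (Φ : ℕ → ℤ) → (∀ k → NonNeg (Φ k)) → (∀ k → NonNeg (Φ k - Φ (suc k) - 1ℤ)) → ⊥
no-infinite-descent Φ Φ≥0 drops = contradiction
  where
  bound : ∀ k → NonNeg (Φ 0 - + k - Φ k)
  bound zero = subst NonNeg (sym (self-cancel (Φ 0))) (nonneg-ℕ 0)
    where
    self-cancel : ∀ A → A - 0ℤ - A ≡ 0ℤ
    self-cancel = solve-∀
  bound (suc k) = nonneg-sum (bound k) (drops k) (chain (Φ 0) (+ k) (Φ k) (Φ (suc k)))
    where
    chain : ∀ A K B C → (A - K - B) + (B - C - 1ℤ) ≡ A - (1ℤ + K) - C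
    chain = solve-∀
  steps = suc ℤ.∣ Φ 0 ∣
  add-back : ∀ A K Q → (A - K - Q) + Q ≡ A - K
  add-back = solve-∀
  overshoot : ∀ x → x - (1ℤ + x) ≡ -1ℤ
  overshoot = solve-∀
  -1-negative : ¬ NonNeg -1ℤ
  -1-negative ()
  contradiction : ⊥
  contradiction =
    -1-negative (subst NonNeg (overshoot (+ ℤ.∣ Φ 0 ∣))
                  (subst (λ x → NonNeg (x - + steps)) (sym (ℤP.0≤i⇒+∣i∣≡i (Φ≥0 0)))
                    (nonneg-sum (bound steps) (Φ≥0 steps) (add-back (Φ 0) (+ steps) (Φ steps)))))

module Termination (D : Diagram) (connected : BoundaryConnected D) (seq : ℕ → Diagram)
                   (starts : seq 0 ≡ D) (steps : ∀ k → RightStep (seq k) (seq (suc k))) where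

  size-preserved : ∀ k → N (seq k) ≡ N D
  size-preserved zero = cong N starts
  size-preserved (suc k) with steps k
  ... | _ , _ , _ , seq-1+k≡ = trans (cong N seq-1+k≡) (size-preserved k)

  Realised : Diagram → (ℕ → ℕ → ℤ) → Set
  Realised D′ g = ∀ a b → a ℕ.< N D → b ℕ.< N D →
    Σ (Witness (layoutOf D′) (N D) a b) λ w → slack w ≡ g a b

  Ψ : (ℕ → ℕ → ℤ) → ℤ
  Ψ g = doubleSum g (N D)

  Ψ-nonneg : ∀ {D′ g} → Realised D′ g → NonNeg (Ψ g)
  Ψ-nonneg realised =
    sum-nonneg (N D) λ a a<N → sum-nonneg (N D) λ b b<N →
      subst NonNeg (proj₂ (realised a b a<N b<N)) (slack-nonneg (proj₁ (realised a b a<N b<N)))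

  initial : Σ (ℕ → ℕ → ℤ) (Realised D)
  initial = table , realised
    where
    witness = DiagramGraph.witness⇒ D connected
    table : ℕ → ℕ → ℤ
    table a b with a ℕ.<? N D | b ℕ.<? N D
    ... | yes a<N | yes b<N = slack (witness a b a<N b<N)
    ... | _ | _ = 0ℤ
    realised : Realised D table
    realised a b a<N b<N with a ℕ.<? N D | b ℕ.<? N D
    ... | yes a<N′ | yes b<N′ = witness a b a<N′ b<N′ , refl
    ... | no a≮N | _ = ⊥-elim (a≮N a<N)
    ... | yes _ | no b≮N = ⊥-elim (b≮N b<N)

  -- Each exchange lowers the potential: witnesses are pulled back along τ,
  -- and the pairs {n, n+1} lose one unit of slack.
  exchange-lowers : ∀ k g → Realised (seq k) g →
    Σ (ℕ → ℕ → ℤ) λ g′ → Realised (seq (suc k)) g′ × NonNeg (Ψ g - Ψ g′ - 1ℤ)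
  exchange-lowers k g realised with steps k
  ... | n , p , admissible , seq-1+k≡ rewrite seq-1+k≡ =
    (λ a b → g (τ a) (τ b) - δ (τ b) (τ a)) , realised′ ,
    subst NonNeg (sym (trans (cong (λ u → Ψ g - u - 1ℤ) (doubleSum-relabel g))
                             (lose (Ψ g) (doubleSum (λ a b → δ b a) (N D)))))
          crossings-positive
    where
    open Transposition n
    1+n<N : suc n ℕ.< N D
    1+n<N = subst (suc n ℕ.<_) (size-preserved k) p
    open TransposedSums n (N D) 1+n<N
    open WitnessTransport (DiagramExchange.exchange (seq k) n p admissible) 1+n<N
    lose : ∀ P Q → P - (P - Q) - 1ℤ ≡ Q - 1ℤ
    lose = solve-∀
    τ< : ∀ {a} → a ℕ.< N D → τ a ℕ.< N D
    τ< {a} a<N with level a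
    ... | is-n refl = subst (ℕ._< N D) (sym τ-n) 1+n<N
    ... | is-1+n refl = subst (ℕ._< N D) (sym τ-1+n) (ℕP.<-trans (ℕP.n<1+n n) 1+n<N)
    ... | other a≢n a≢1+n = subst (ℕ._< N D) (sym (τ-other a≢n a≢1+n)) a<N
    realised′ : Realised (rightExchange (seq k) n p) (λ a b → g (τ a) (τ b) - δ (τ b) (τ a))
    realised′ a b a<N b<N with realised (τ a) (τ b) (τ< a<N) (τ< b<N)
    ... | w , slack≡ with witness-pulled-back a b w
    ...   | w′ , slack′≡ = w′ , trans slack′≡ (cong (λ u → u - δ (τ b) (τ a)) slack≡)

  tables : ∀ k → Σ (ℕ → ℕ → ℤ) (Realised (seq k))
  tables zero = subst (λ D′ → Σ (ℕ → ℕ → ℤ) (Realised D′)) (sym starts) initial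
  tables (suc k) = proj₁ lowered , proj₁ (proj₂ lowered)
    where
    lowered = exchange-lowers k (proj₁ (tables k)) (proj₂ (tables k))

  impossible : ⊥
  impossible =
    no-infinite-descent (λ k → Ψ (proj₁ (tables k))) (λ k → Ψ-nonneg {seq k} (proj₂ (tables k)))
      (λ k → proj₂ (proj₂ (exchange-lowers k (proj₁ (tables k)) (proj₂ (tables k)))))

-- Corollary 3.2: right reductions on boundary-connected diagrams terminate.
corollary32 : (D : Diagram) → Valid D → BoundaryConnected D → ¬ InfiniteRightSequence D
corollary32 D _ connected (seq , starts , steps) = Termination.impossible D connected seq starts steps
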